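{- Let $\bm k$ be a field and let $\Omega$ be a set endowed with a commutative semigroup law. Let $\mathcal H^\Omega$ be the $\bm k$-vector space with basis the set $\Omega^*$ of words on $\Omega$ (including the empty word $\mathbb 1$), endowed with the quasi-shuffle product $⧢$, the deconcatenation coproduct $\Delta$, and the coproduct $\Gamma$ defined in the context. Then: (i) $\Gamma:\mathcal H^\Omega\to\mathcal H^\Omega\otimes\mathcal H^\Omega$ is coassociative, noncocommutative and compatible with the quasi-shuffle product, i.e. $\Gamma(u⧢v)=\Gamma(u)⧢\Gamma(v)$ (product in $\mathcal H^\Omega\otimes\mathcal H^\Omega$ taken factorwise), so that $(\mathcal H^\Omega,⧢,\Gamma)$ is a bialgebra; (ii) the Hopf algebra $(\mathcal H^\Omega,⧢,\Delta)$ is a right comodule-Hopf algebra over the bialgebra $(\mathcal H^\Omega,⧢,\Gamma)$, in the sense that $(\Delta\otimes\mathrm{Id})\circ\Gamma=(\mathrm{Id}\otimes\mathrm{Id}\otimes ⧢)\circ\tau_{23}\circ(\Gamma\otimes\Gamma)\circ\Delta$, $(\varepsilon\otimes\mathrm{Id})\circ\Gamma=u\circ\varepsilon$, $(S\otimes\mathrm{Id})\circ\Gamma=\Gamma\circ S$, where all maps involved are algebra morphisms for the quasi-shuffle product. Here $\tau_{23}$ exchanges the second and third tensor factors of $(\mathcal H^\Omega)^{\otimes 4}$, $⧢$ in the first identity denotes the multiplication map $\mathcal H^\Omega\otimes\mathcal H^\Omega\to\mathcal H^\Omega$, $\varepsilon$ is the counit of $\Delta$ (the coefficient of $\mathbb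 1$), $u:\bm k\to\mathcal H^\Omega$, $\lambda\mapsto\lambda\mathbb 1$, is the unit, and $S$ is the antipode of $(\mathcal H^\Omega,⧢,\Delta)$.
   Context: The semigroup law on $\Omega$ is written additively, and $[a+b]\in\Omega$ denotes the internal sum of letters $a,b\in\Omega$ (as opposed to formal linear combinations). For a nonempty word $\bm\omega=\omega_1\cdots\omega_n$, its weight is $\|\bm\omega\|=[\omega_1+\cdots+\omega_n]\in\Omega$, viewed as a one-letter word. The quasi-shuffle product is the bilinear product on $\mathcal H^\Omega$ with $\bm\omega⧢\mathbb 1=\mathbb 1⧢\bm\omega=\bm\omega$ and, for letters $a,b$ and words $\bm\omega',\bm\omega''$, $a\bm\omega'⧢b\bm\omega''=a(\bm\omega'⧢b\bm\omega'')+b(a\bm\omega'⧢\bm\omega'')+[a+b](\bm\omega'⧢\bm\omega'')$; it is commutative and associative with unit $\mathbb 1$. The deconcatenation coproduct is $\Delta(\bm\omega)=\sum_{\bm\omega'\bm\omega''=\bm\omega}\bm\omega'\otimes\bm\omega''$ (sum over all ways of writing $\bm\omega$ as a concatenation of two possibly empty words); $(\mathcal H^\Omega,⧢,\Delta)$ is a Hopf algebra. The coproduct $\Gamma$ is defined on a nonempty word by $\Gamma(\bm\omega)=\sum_{s\ge1}\sum_{\bm\omega=\bm\omega^1\cdots\bm\omega^s}\|\bm\omega^1\|\cdots\|\bm\omega^s\|\otimes\bm\omega^1⧢\cdots⧢\bm\omega^s$, the inner sum running over all decompositions of $\bm\omega$ as a concatenation of $s$ nonempty words, and $\Gamma(\mathbb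 1)=\mathbb 1\otimes\mathbb 1$; $\Gamma$ is extended linearly. -}

module Defs where

open import Level using (Level; _⊔_) renaming (suc to lsuc)
open import Algebra.Bundles using (CommutativeRing)
open import Data.List using (List; []; _∷_; _++_; map; concatMap; foldr)
open import Data.List.NonEmpty as L⁺ using (List⁺; toList; foldr₁)
open import Data.Product using (_×_; _,_; ∃)
open import Relation.Nullary using (¬_)

record Field (c ℓ : Level) : Set (lsuc (c ⊔ ℓ)) where
  field
    commutativeRing : CommutativeRing c ℓ
  open CommutativeRing commutativeRing public
  field
    1≉0     : ¬ (1# ≈ 0#)
    inverse : ∀ x → ¬ (x ≈ 0#) → ∃ λ y → x * y ≈ 1#

-- The k-vector space with basis B, as formal finite linear combinations
-- (lists of (coefficient , basis element)) modulo the congruence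
-- generated by: reordering, coefficient equality in k, merging equal
-- basis elements and dropping zero terms.

module FreeVectorSpace {c ℓ : Level} (K : Field c ℓ) where
  open Field K

  Lin : ∀ {b} → Set b → Set (c ⊔ b)
  Lin B = List (Carrier × B)

  infix 4 _∼_
  data _∼_ {b} {B : Set b} : Lin B → Lin B → Set (c ⊔ ℓ ⊔ b) where
    ∼-refl  : ∀ {u} → u ∼ u
    ∼-sym   : ∀ {u v} → u ∼ v → v ∼ u
    ∼-trans : ∀ {u v w} → u ∼ v → v ∼ w → u ∼ w
    ∼-++    : ∀ {u u′ v v′} → u ∼ u′ → v ∼ v′ → u ++ v ∼ u′ ++ v′
    ∼-swap  : ∀ x y → x ∷ y ∷ [] ∼ y ∷ x ∷ []
    ∼-coef  : ∀ {x y} (e : B) → x ≈ y → (x , e) ∷ [] ∼ (y , e) ∷ []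
    ∼-merge : ∀ x y (e : B) → (x , e) ∷ (y , e) ∷ [] ∼ (x + y , e) ∷ []
    ∼-zero  : ∀ (e : B) → (0# , e) ∷ [] ∼ []

  ⟦_⟧ : ∀ {b} {B : Set b} → B → Lin B
  ⟦ e ⟧ = (1# , e) ∷ []

  scale : ∀ {b} {B : Set b} → Carrier → Lin B → Lin B
  scale k = map (λ { (x , e) → (k * x , e) })

  ext : ∀ {a b} {A : Set a} {B : Set b} → (A → Lin B) → Lin A → Lin B
  ext f = concatMap (λ { (x , e) → scale x (f e) })

  evalL : ∀ {a} {A : Set a} → (A → Carrier) → Lin A → Carrier
  evalL f = foldr (λ { (x , e) acc → x * f e + acc }) 0#

  _⊗_ : ∀ {a b} {A : Set a} {B : Set b} → Lin A → Lin B → Lin (A × B)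
  u ⊗ v = concatMap (λ { (x , a) → map (λ { (y , b) → (x * y , (a , b)) }) v }) u

  _⊗ᶠ_ : ∀ {a b a′ b′} {A : Set a} {B : Set b} {A′ : Set a′} {B′ : Set b′} →
         (A → Lin A′) → (B → Lin B′) → A × B → Lin (A′ × B′)
  (f ⊗ᶠ g) (a , b) = f a ⊗ g b

module QuasiShuffle {c ℓ o : Level} (K : Field c ℓ) (Ω : Set o) (_⊕_ : Ω → Ω → Ω) where
  open Field K
  open FreeVectorSpace K public

  Word : Set o
  Word = List Ω

  H : Set (c ⊔ o)
  H = Lin Word

  𝟙 : H
  𝟙 = ⟦ [] ⟧

  cons : Ω → H → H
  cons a = map (λ { (x , w) → (x , a ∷ w) })

  sh : Word → Word → H
  sh [] v = ⟦ v ⟧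
  sh (a ∷ u) [] = ⟦ a ∷ u ⟧
  sh (a ∷ u) (b ∷ v) = cons a (sh u (b ∷ v)) ++ cons b (sh (a ∷ u) v) ++ cons (a ⊕ b) (sh u v)

  infixl 7 _⧢_
  _⧢_ : H → H → H
  u ⧢ v = ext (λ a → ext (λ b → sh a b) v) u

  infixl 7 _⧢₂_
  _⧢₂_ : Lin (Word × Word) → Lin (Word × Word) → Lin (Word × Word)
  x ⧢₂ y = ext (λ { (a₁ , a₂) → ext (λ { (b₁ , b₂) → sh a₁ b₁ ⊗ sh a₂ b₂ }) y }) x

  ‖_‖ : List⁺ Ω → Ω
  ‖ p ‖ = foldr₁ _⊕_ p

  -- all decompositions of a word as a concatenation of nonempty words
  -- (the empty word has exactly one decomposition, with s = 0 parts)
  compositions : Word → List (List (List⁺ Ω))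
  compositions [] = [] ∷ []
  compositions (x ∷ xs) = concatMap step (compositions xs)
    where
    step : List (List⁺ Ω) → List (List (List⁺ Ω))
    step [] = (L⁺.[ x ] ∷ []) ∷ []
    step (p ∷ ps) = (L⁺.[ x ] ∷ p ∷ ps) ∷ ((x L⁺.∷⁺ p) ∷ ps) ∷ []

  shuffleAll : List (List⁺ Ω) → H
  shuffleAll = foldr (λ p acc → ⟦ toList p ⟧ ⧢ acc) 𝟙

  Γw : Word → Lin (Word × Word)
  Γw [] = ⟦ ([] , []) ⟧
  Γw (x ∷ xs) = concatMap (λ ps → ⟦ map ‖_‖ ps ⟧ ⊗ shuffleAll ps) (compositions (x ∷ xs))

  Γ : H → Lin (Word × Word)
  Γ = ext Γw

  splits : Word → List (Word × Word)
  splits [] = ([] , []) ∷ []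
  splits (x ∷ xs) = ([] , x ∷ xs) ∷ map (λ { (u , v) → (x ∷ u , v) }) (splits xs)

  Δw : Word → Lin (Word × Word)
  Δw w = map (λ s → (1# , s)) (splits w)

  Δ : H → Lin (Word × Word)
  Δ = ext Δw

  ε : Word → Carrier
  ε [] = 1#
  ε (_ ∷ _) = 0#

  uε : H → H
  uε = ext (λ w → scale (ε w) 𝟙)

  idᶠ : ∀ {b} {B : Set b} → B → Lin B
  idᶠ = ⟦_⟧

  assocʳ : ∀ {a b d} {A : Set a} {B : Set b} {D : Set d} → Lin ((A × B) × D) → Lin (A × (B × D))
  assocʳ = map (λ { (x , ((a , b) , d)) → (x , (a , (b , d))) })

  flipT : Lin (Word × Word) → Lin (Word × Word)
  flipT = map (λ { (x , (a , b)) → (x , (b , a)) })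

  -- (Id ⊗ Id ⊗ ⧢) ∘ τ₂₃ on basis elements of H^{⊗4} = (H ⊗ H) ⊗ (H ⊗ H)
  m₂₄τ : (Word × Word) × (Word × Word) → Lin ((Word × Word) × Word)
  m₂₄τ ((x₁ , x₂) , (x₃ , x₄)) = map (λ { (k , w) → (k , ((x₁ , x₃) , w)) }) (sh x₂ x₄)

  -- (f ⊗ Id) where f : H → k, landing in k ⊗ H ≅ H
  _⊗Idₖ : (Word → Carrier) → Word × Word → H
  (f ⊗Idₖ) (a , b) = scale (f a) ⟦ b ⟧

  Idₖ⊗_ : (Word → Carrier) → Word × Word → H
  (Idₖ⊗ f) (a , b) = scale (f b) ⟦ a ⟧

  m[_⊗Id] : (Word → H) → Word × Word → H
  m[ S ⊗Id] (a , b) = S a ⧢ ⟦ b ⟧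

  m[Id⊗_] : (Word → H) → Word × Word → H
  m[Id⊗ S ] (a , b) = ⟦ a ⟧ ⧢ S b

  IsAntipode : (Word → H) → Set (c ⊔ ℓ ⊔ o)
  IsAntipode S = (∀ u → ext m[ S ⊗Id] (Δ u) ∼ uε u) × (∀ u → ext m[Id⊗ S ] (Δ u) ∼ uε u)

  Cocommutative : Set (c ⊔ ℓ ⊔ o)
  Cocommutative = ∀ u → Γ u ∼ flipT (Γ u)

-- Everything rests on a recursion for Γ on basis words: the first block of a composition
-- of x w is x p for a prefix p of w = p q, so Γ(x w) = Σ B_{x,p}(Γ q), where B_{x,p} sends
-- W ⊗ P to [‖x p‖ W] ⊗ (x p ⧢ P). Multiplicativity compares this recursion with the
-- quasi-shuffle recursion: in Γ(a u) ⧢ Γ(b v) the block of a, the block of b, or their merge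
-- comes first, and merged blocks carry the right weight because ⧢ preserves weights. The
-- comodule identity follows from the same recursion and coassociativity of Δ, and
-- coassociativity of Γ then follows from the comodule identity. For the antipode, (S ⊗ id) ∘ Γ
-- and Γ ∘ S are a left and a right inverse of Γ for the convolution built from Δ and ⧢, which
-- is associative, so they agree. Noncocommutativity is read off the coefficient of ab ⊗ ba
-- in Γ(ab).

module Submission where

open import Level using (Level; _⊔_)
open import Algebra.Bundles using (CommutativeMonoid)
open import Algebra.Structures using (IsCommutativeSemigroup)
open import Data.Empty using (⊥-elim)
open import Data.List using (List; []; _∷_; _++_; map; concatMap)
open import Data.List.NonEmpty as L⁺ using (List⁺; toList)
open import Data.List.Properties using (∷-injectiveˡ; ++-assoc; ++-identityʳ; map-++; concatMap-++; concatMap-map; concatMap-cong)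
open import Data.List.Relation.Unary.All as All using (All; []; _∷_)
open import Data.List.Relation.Unary.All.Properties using (concat⁺; map⁺)
open import Data.Maybe using (Maybe; just; nothing)
open import Data.Maybe.Properties using (just-injective)
open import Data.Product using (_×_; _,_; proj₁; proj₂; ∃; ∃₂)
open import Data.Product.Properties using (,-injectiveˡ; ,-injectiveʳ)
open import Relation.Binary.Bundles using (Setoid)
open import Relation.Binary.PropositionalEquality as ≡ using (_≡_; refl)
open import Relation.Binary.Structures using (IsEquivalence)
import Relation.Binary.Reasoning.Setoid as SR
open import Relation.Nullary using (¬_; Dec; yes; no)
open import Relation.Nullary.Decidable using (¬¬-excluded-middle)
open import Relation.Nullary.Negation using (DoubleNegation)
import Algebra.Properties.CommutativeSemigroup as CommutativeSemigroupProperties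
import Algebra.Solver.CommutativeMonoid as CommutativeMonoidSolver

open import Defs

module LinearAlgebra {c ℓ} (K : Field c ℓ) where

  open Field K renaming (refl to ≈-refl; sym to ≈-sym; trans to ≈-trans)
  open FreeVectorSpace K public

  private variable
    a a′ b b′ d e : Level
    A : Set a
    A′ : Set a′
    B : Set b
    B′ : Set b′
    D D′ : Set d
    E : Set e

  ∼-reflexive : {u v : Lin B} → u ≡ v → u ∼ v
  ∼-reflexive refl = ∼-refl

  ∼-isEquivalence : IsEquivalence (_∼_ {B = B})
  ∼-isEquivalence = record { refl = ∼-refl ; sym = ∼-sym ; trans = ∼-trans }

  ∼-setoid : Set b → Setoid (c ⊔ b) (c ⊔ ℓ ⊔ b)
  ∼-setoid B = record { isEquivalence = ∼-isEquivalence {B = B} }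

  infixr 5 _⟨++⟩_
  _⟨++⟩_ : {u u′ v v′ : Lin B} → u ∼ u′ → v ∼ v′ → u ++ v ∼ u′ ++ v′
  _⟨++⟩_ = ∼-++

  ++-congˡ : ∀ (u : Lin B) {v v′} → v ∼ v′ → u ++ v ∼ u ++ v′
  ++-congˡ u p = ∼-++ ∼-refl p

  ++-congʳ : ∀ {u u′ : Lin B} v → u ∼ u′ → u ++ v ∼ u′ ++ v
  ++-congʳ v p = ∼-++ p ∼-refl

  ∷-comm : ∀ (x : Carrier × B) (v : Lin B) → x ∷ v ∼ v ++ (x ∷ [])
  ∷-comm x [] = ∼-refl
  ∷-comm x (y ∷ v) = ∼-trans (∼-++ {u = x ∷ y ∷ []} (∼-swap x y) ∼-refl) (++-congˡ (y ∷ []) (∷-comm x v))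

  ++-comm : ∀ (u v : Lin B) → u ++ v ∼ v ++ u
  ++-comm [] v = ∼-reflexive (≡.sym (++-identityʳ v))
  ++-comm (x ∷ u) v = ∼-trans (++-congˡ (x ∷ []) (++-comm u v))
    (∼-trans (++-congʳ u (∷-comm x v)) (∼-reflexive (++-assoc v (x ∷ []) u)))

  ++-commutativeMonoid : Set b → CommutativeMonoid (c ⊔ b) (c ⊔ ℓ ⊔ b)
  ++-commutativeMonoid B = record
    { Carrier = Lin B ; _≈_ = _∼_ ; _∙_ = _++_ ; ε = []
    ; isCommutativeMonoid = record
      { isMonoid = record
        { isSemigroup = record
          { isMagma = record { isEquivalence = ∼-isEquivalence ; ∙-cong = ∼-++ }
          ; assoc = λ x y z → ∼-reflexive (++-assoc x y z) }
        ; identity = (λ x → ∼-refl) , (λ x → ∼-reflexive (++-identityʳ x)) }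
      ; comm = ++-comm } }

  module ++-Solver {b} (B : Set b) = CommutativeMonoidSolver (++-commutativeMonoid B)

  module _ {b} {B : Set b} where
    open CommutativeSemigroupProperties (CommutativeMonoid.commutativeSemigroup (++-commutativeMonoid B))

    ++-interchange : ∀ (u v w z : Lin B) → (u ++ v) ++ (w ++ z) ∼ (u ++ w) ++ (v ++ z)
    ++-interchange = interchange

    ++-swapˡ : ∀ (u v w : Lin B) → u ++ (v ++ w) ∼ v ++ (u ++ w)
    ++-swapˡ = x∙yz≈y∙xz

  scale-congˡ : ∀ {x y} (w : Lin B) → x ≈ y → scale x w ∼ scale y w
  scale-congˡ [] p = ∼-refl
  scale-congˡ ((z , e) ∷ w) p = ∼-++ (∼-coef e (*-congʳ p)) (scale-congˡ w p)

  scale-++ : ∀ k (u v : Lin B) → scale k (u ++ v) ≡ scale k u ++ scale k v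
  scale-++ k u v = map-++ _ u v

  scale-congʳ : ∀ k {u v : Lin B} → u ∼ v → scale k u ∼ scale k v
  scale-congʳ k ∼-refl = ∼-refl
  scale-congʳ k (∼-sym p) = ∼-sym (scale-congʳ k p)
  scale-congʳ k (∼-trans p q) = ∼-trans (scale-congʳ k p) (scale-congʳ k q)
  scale-congʳ k (∼-++ {u} {u′} {v} {v′} p q) = ∼-trans (∼-reflexive (scale-++ k u v))
    (∼-trans (∼-++ (scale-congʳ k p) (scale-congʳ k q)) (∼-reflexive (≡.sym (scale-++ k u′ v′))))
  scale-congʳ k (∼-swap x y) = ∼-swap _ _
  scale-congʳ k (∼-coef e p) = ∼-coef e (*-congˡ p)
  scale-congʳ k (∼-merge x y e) = ∼-trans (∼-merge _ _ e) (∼-coef e (≈-sym (distribˡ k x y)))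
  scale-congʳ k (∼-zero e) = ∼-trans (∼-coef e (zeroʳ k)) (∼-zero e)

  scale-+ : ∀ x y (w : Lin B) → scale (x + y) w ∼ scale x w ++ scale y w
  scale-+ x y [] = ∼-refl
  scale-+ x y ((z , e) ∷ w) =
    ∼-trans (∼-++ {u = (_ , e) ∷ []} (∼-trans (∼-coef e (distribʳ z x y)) (∼-sym (∼-merge _ _ e))) (scale-+ x y w))
      (++-congˡ (_ ∷ []) (++-swapˡ (_ ∷ []) (scale x w) (scale y w)))

  scale-zeroˡ : ∀ (w : Lin B) → scale 0# w ∼ []
  scale-zeroˡ [] = ∼-refl
  scale-zeroˡ ((z , e) ∷ w) = ∼-++ {v′ = []} (∼-trans (∼-coef e (zeroˡ z)) (∼-zero e)) (scale-zeroˡ w)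

  scale-identityˡ : ∀ (w : Lin B) → scale 1# w ∼ w
  scale-identityˡ [] = ∼-refl
  scale-identityˡ ((z , e) ∷ w) = ∼-++ (∼-coef e (*-identityˡ z)) (scale-identityˡ w)

  scale-assoc : ∀ x y (w : Lin B) → scale x (scale y w) ∼ scale (x * y) w
  scale-assoc x y [] = ∼-refl
  scale-assoc x y ((z , e) ∷ w) = ∼-++ (∼-coef e (≈-sym (*-assoc x y z))) (scale-assoc x y w)

  ext-++ : ∀ (f : A → Lin B) u v → ext f (u ++ v) ≡ ext f u ++ ext f v
  ext-++ f [] v = refl
  ext-++ f ((x , e) ∷ u) v = ≡.trans (≡.cong (scale x (f e) ++_) (ext-++ f u v)) (≡.sym (++-assoc (scale x (f e)) _ _))

  ext-cong : ∀ (f : A → Lin B) {u v} → u ∼ v → ext f u ∼ ext f v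
  ext-cong f ∼-refl = ∼-refl
  ext-cong f (∼-sym p) = ∼-sym (ext-cong f p)
  ext-cong f (∼-trans p q) = ∼-trans (ext-cong f p) (ext-cong f q)
  ext-cong f (∼-++ {u} {u′} {v} {v′} p q) = ∼-trans (∼-reflexive (ext-++ f u v))
    (∼-trans (∼-++ (ext-cong f p) (ext-cong f q)) (∼-reflexive (≡.sym (ext-++ f u′ v′))))
  ext-cong f (∼-swap (x , e) (y , e′)) = ∼-trans (++-congˡ (scale x (f e)) (∼-reflexive (++-identityʳ _)))
    (∼-trans (++-comm (scale x (f e)) _) (++-congˡ (scale y (f e′)) (∼-reflexive (≡.sym (++-identityʳ _)))))
  ext-cong f (∼-coef e p) = ++-congʳ [] (scale-congˡ (f e) p)
  ext-cong f (∼-merge x y e) = ∼-trans (∼-reflexive (≡.sym (++-assoc (scale x (f e)) _ [])))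
    (++-congʳ [] (∼-sym (scale-+ x y (f e))))
  ext-cong f (∼-zero e) = ++-congʳ [] (scale-zeroˡ (f e))

  ext-pointwise : ∀ {f g : A → Lin B} (u : Lin A) → (∀ e → f e ∼ g e) → ext f u ∼ ext g u
  ext-pointwise [] h = ∼-refl
  ext-pointwise ((x , e) ∷ u) h = ∼-++ (scale-congʳ x (h e)) (ext-pointwise u h)

  ext-scale : ∀ (f : A → Lin B) k u → ext f (scale k u) ∼ scale k (ext f u)
  ext-scale f k [] = ∼-refl
  ext-scale f k ((x , e) ∷ u) = ∼-trans (∼-++ (∼-sym (scale-assoc k x (f e))) (ext-scale f k u))
    (∼-reflexive (≡.sym (scale-++ k (scale x (f e)) _)))

  ext-basis : ∀ (f : A → Lin B) e → ext f ⟦ e ⟧ ∼ f e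
  ext-basis f e = ∼-trans (∼-reflexive (++-identityʳ _)) (scale-identityˡ (f e))

  ext-zero : ∀ {f : A → Lin B} (u : Lin A) → (∀ e → f e ∼ []) → ext f u ∼ []
  ext-zero [] h = ∼-refl
  ext-zero ((x , e) ∷ u) h = ∼-++ {v′ = []} (scale-congʳ x (h e)) (ext-zero u h)

  ext-empty : ∀ (u : Lin A) → ext {B = B} (λ _ → []) u ∼ []
  ext-empty u = ext-zero u (λ _ → ∼-refl)

  ext-scale-zero : ∀ (u : Lin A) (f : A → Lin B) → ext (λ e → scale 0# (f e)) u ∼ []
  ext-scale-zero u f = ext-zero u (λ e → scale-zeroˡ (f e))

  ext-++ᶠ : ∀ (f g : A → Lin B) u → ext (λ e → f e ++ g e) u ∼ ext f u ++ ext g u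
  ext-++ᶠ f g [] = ∼-refl
  ext-++ᶠ f g ((x , e) ∷ u) = ∼-trans (∼-++ (∼-reflexive (scale-++ x (f e) (g e))) (ext-++ᶠ f g u))
    (++-interchange (scale x (f e)) _ _ _)

  ext-scaleᶠ : ∀ (f : A → Lin B) k u → ext (λ e → scale k (f e)) u ∼ scale k (ext f u)
  ext-scaleᶠ f k [] = ∼-refl
  ext-scaleᶠ f k ((x , e) ∷ u) =
    ∼-trans (∼-++ (∼-trans (scale-assoc x k (f e)) (∼-trans (scale-congˡ (f e) (*-comm x k)) (∼-sym (scale-assoc k x (f e)))))
                  (ext-scaleᶠ f k u))
      (∼-reflexive (≡.sym (scale-++ k (scale x (f e)) _)))

  ext-⟦⟧ : ∀ (u : Lin B) → ext ⟦_⟧ u ∼ u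
  ext-⟦⟧ [] = ∼-refl
  ext-⟦⟧ ((x , e) ∷ u) = ∼-++ {u = (x * 1# , e) ∷ []} (∼-coef e (*-identityʳ x)) (ext-⟦⟧ u)

  ext-ext : ∀ (f : B → Lin D) (g : A → Lin B) u → ext f (ext g u) ∼ ext (λ e → ext f (g e)) u
  ext-ext f g [] = ∼-refl
  ext-ext f g ((x , e) ∷ u) = ∼-trans (∼-reflexive (ext-++ f (scale x (g e)) _))
    (∼-++ (ext-scale f x (g e)) (ext-ext f g u))

  ext-comm : ∀ (h : A → B → Lin D) u v → ext (λ x → ext (λ y → h x y) v) u ∼ ext (λ y → ext (λ x → h x y) u) v
  ext-comm h [] v = ∼-sym (ext-empty v)
  ext-comm h ((x , e) ∷ u) v = ∼-trans (∼-++ (∼-sym (ext-scaleᶠ (h e) x v)) (ext-comm h u v))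
    (∼-sym (ext-++ᶠ (λ y → scale x (h e y)) _ v))

  relabel : (A → B) → Lin A → Lin B
  relabel h = map (λ p → (proj₁ p , h (proj₂ p)))

  relabel-as-ext : ∀ (h : A → B) u → relabel h u ∼ ext (λ e → ⟦ h e ⟧) u
  relabel-as-ext h [] = ∼-refl
  relabel-as-ext h ((x , e) ∷ u) = ∼-++ {u = (x , h e) ∷ []} (∼-coef _ (≈-sym (*-identityʳ x))) (relabel-as-ext h u)

  relabel-++ : ∀ (h : A → B) u v → relabel h (u ++ v) ≡ relabel h u ++ relabel h v
  relabel-++ h u v = map-++ _ u v

  relabel-scale : ∀ (h : A → B) k u → relabel h (scale k u) ≡ scale k (relabel h u)
  relabel-scale h k [] = refl
  relabel-scale h k ((x , e) ∷ u) = ≡.cong (_ ∷_) (relabel-scale h k u)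

  relabel-cong : ∀ (h : A → B) {u v} → u ∼ v → relabel h u ∼ relabel h v
  relabel-cong h {u} {v} p = ∼-trans (relabel-as-ext h u) (∼-trans (ext-cong (λ e → ⟦ h e ⟧) p) (∼-sym (relabel-as-ext h v)))

  relabel-ext : ∀ (h : B → D) (g : A → Lin B) u → relabel h (ext g u) ≡ ext (λ e → relabel h (g e)) u
  relabel-ext h g [] = refl
  relabel-ext h g ((x , e) ∷ u) = ≡.trans (relabel-++ h (scale x (g e)) _)
    (≡.cong₂ _++_ (relabel-scale h x (g e)) (relabel-ext h g u))

  ext-relabel : ∀ (f : B → Lin D) (h : A → B) u → ext f (relabel h u) ≡ ext (λ e → f (h e)) u
  ext-relabel f h [] = refl
  ext-relabel f h ((x , e) ∷ u) = ≡.cong (scale x (f (h e)) ++_) (ext-relabel f h u)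

  relabel-relabel : ∀ (f : B → D) (h : A → B) u → relabel f (relabel h u) ≡ relabel (λ e → f (h e)) u
  relabel-relabel f h [] = refl
  relabel-relabel f h ((x , e) ∷ u) = ≡.cong (_ ∷_) (relabel-relabel f h u)

  ext₂ : (A → B → Lin D) → Lin A → Lin B → Lin D
  ext₂ h u v = ext (λ x → ext (λ y → h x y) v) u

  ext₂-congˡ : ∀ (h : A → B → Lin D) {u u′} v → u ∼ u′ → ext₂ h u v ∼ ext₂ h u′ v
  ext₂-congˡ h v p = ext-cong _ p

  ext₂-congʳ : ∀ (h : A → B → Lin D) u {v v′} → v ∼ v′ → ext₂ h u v ∼ ext₂ h u v′
  ext₂-congʳ h u p = ext-pointwise u (λ x → ext-cong _ p)

  ext₂-cong : ∀ (h : A → B → Lin D) {u u′ v v′} → u ∼ u′ → v ∼ v′ → ext₂ h u v ∼ ext₂ h u′ v′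
  ext₂-cong h {u′ = u′} {v = v} p q = ∼-trans (ext₂-congˡ h v p) (ext₂-congʳ h u′ q)

  ext₂-pointwise : ∀ {h h′ : A → B → Lin D} u v → (∀ x y → h x y ∼ h′ x y) → ext₂ h u v ∼ ext₂ h′ u v
  ext₂-pointwise u v q = ext-pointwise u (λ x → ext-pointwise v (q x))

  ext₂-basis : ∀ (h : A → B → Lin D) x y → ext₂ h ⟦ x ⟧ ⟦ y ⟧ ∼ h x y
  ext₂-basis h x y = ∼-trans (ext-basis (λ x → ext (λ y → h x y) ⟦ y ⟧) x) (ext-basis (h x) y)

  ext₂-basisˡ : ∀ (h : A → B → Lin D) x v → ext₂ h ⟦ x ⟧ v ∼ ext (h x) v
  ext₂-basisˡ h x v = ext-basis (λ x → ext (λ y → h x y) v) x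

  ext₂-basisʳ : ∀ (h : A → B → Lin D) u y → ext₂ h u ⟦ y ⟧ ∼ ext (λ x → h x y) u
  ext₂-basisʳ h u y = ext-pointwise u (λ x → ext-basis (h x) y)

  ext₂-++ˡ : ∀ (h : A → B → Lin D) u u′ v → ext₂ h (u ++ u′) v ≡ ext₂ h u v ++ ext₂ h u′ v
  ext₂-++ˡ h u u′ v = ext-++ _ u u′

  ext₂-++ʳ : ∀ (h : A → B → Lin D) u v v′ → ext₂ h u (v ++ v′) ∼ ext₂ h u v ++ ext₂ h u v′
  ext₂-++ʳ h u v v′ = ∼-trans (ext-pointwise u (λ x → ∼-reflexive (ext-++ _ v v′))) (ext-++ᶠ _ _ u)

  ext₂-++ᶠ : ∀ (h₁ h₂ : A → B → Lin D) u v → ext₂ (λ x y → h₁ x y ++ h₂ x y) u v ∼ ext₂ h₁ u v ++ ext₂ h₂ u v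
  ext₂-++ᶠ h₁ h₂ u v = ∼-trans (ext-pointwise u (λ x → ext-++ᶠ (h₁ x) (h₂ x) v)) (ext-++ᶠ _ _ u)

  ext₂-extˡ : ∀ (h : A → B → Lin D) (g : A′ → Lin A) u v → ext₂ h (ext g u) v ∼ ext (λ x → ext₂ h (g x) v) u
  ext₂-extˡ h g u v = ext-ext _ g u

  ext₂-extʳ : ∀ (h : A → B → Lin D) (g : B′ → Lin B) u v → ext₂ h u (ext g v) ∼ ext (λ y → ext₂ h u (g y)) v
  ext₂-extʳ h g u v = ∼-trans (ext-pointwise u (λ x → ext-ext (h x) g v)) (ext-comm _ u v)

  ext₂-extˡ′ : ∀ (h : A → B → Lin D) (g : A′ → Lin A) u v → ext₂ h (ext g u) v ∼ ext₂ (λ x y → ext (λ w → h w y) (g x)) u v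
  ext₂-extˡ′ h g u v = ∼-trans (ext-ext _ g u) (ext-pointwise u (λ x → ext-comm h (g x) v))

  ext₂-extʳ′ : ∀ (h : A → B → Lin D) (g : B′ → Lin B) u v → ext₂ h u (ext g v) ∼ ext₂ (λ x y → ext (h x) (g y)) u v
  ext₂-extʳ′ h g u v = ext-pointwise u (λ x → ext-ext (h x) g v)

  ext₂-ext : ∀ (h : A → B → Lin D) (f : A′ → Lin A) (g : B′ → Lin B) u v →
             ext₂ h (ext f u) (ext g v) ∼ ext₂ (λ x y → ext₂ h (f x) (g y)) u v
  ext₂-ext h f g u v = ∼-trans (ext₂-extˡ h f u (ext g v)) (ext-pointwise u (λ x → ext₂-extʳ h g (f x) v))

  ext₂-comm : ∀ (h : A → A → Lin D) → (∀ x y → h x y ∼ h y x) → ∀ u v → ext₂ h u v ∼ ext₂ h v u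
  ext₂-comm h comm u v = ∼-trans (ext-comm h u v) (ext₂-pointwise v u (λ x y → comm y x))

  ext₂-assoc : ∀ (h : A → A → Lin A) → (∀ x y z → ext (λ t → h t z) (h x y) ∼ ext (h x) (h y z)) →
               ∀ u v w → ext₂ h (ext₂ h u v) w ∼ ext₂ h u (ext₂ h v w)
  ext₂-assoc h assoc u v w = ∼-trans (ext₂-extˡ h (λ x → ext (h x) v) u w)
    (ext-pointwise u (λ x → ∼-trans (ext₂-extˡ h (h x) v w)
      (∼-trans (ext-pointwise v (λ y → ∼-trans (ext-comm h (h x y) w) (ext-pointwise w (assoc x y))))
      (∼-sym (∼-trans (ext-ext (h x) (λ y → ext (h y) w) v) (ext-pointwise v (λ y → ext-ext (h x) (h y) w)))))))

  ext-ext₂ : ∀ (f : D → Lin E) (h : A → B → Lin D) u v → ext f (ext₂ h u v) ∼ ext₂ (λ x y → ext f (h x y)) u v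
  ext-ext₂ f h u v = ∼-trans (ext-ext f _ u) (ext-pointwise u (λ x → ext-ext f (h x) v))

  ext₂-relabelˡ : ∀ (h : A → B → Lin D) (f : A′ → A) u v → ext₂ h (relabel f u) v ∼ ext₂ (λ x y → h (f x) y) u v
  ext₂-relabelˡ h f u v = ∼-reflexive (ext-relabel _ f u)

  ext₂-relabelʳ : ∀ (h : A → B → Lin D) (g : B′ → B) u v → ext₂ h u (relabel g v) ∼ ext₂ (λ x y → h x (g y)) u v
  ext₂-relabelʳ h g u v = ext-pointwise u (λ x → ∼-reflexive (ext-relabel (h x) g v))

  ext₂-relabel : ∀ (h : A → B → Lin D) (f : A′ → A) (g : B′ → B) u v →
                 ext₂ h (relabel f u) (relabel g v) ∼ ext₂ (λ x y → h (f x) (g y)) u v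
  ext₂-relabel h f g u v = ∼-trans (ext₂-relabelˡ h f u (relabel g v)) (ext₂-relabelʳ _ g u v)

  relabel-ext₂ : ∀ (k : D → D′) (h : A → B → Lin D) u v → relabel k (ext₂ h u v) ∼ ext₂ (λ x y → relabel k (h x y)) u v
  relabel-ext₂ k h u v = ∼-trans (∼-reflexive (relabel-ext k _ u)) (ext-pointwise u (λ x → ∼-reflexive (relabel-ext k (h x) v)))

  pairBasis : A → B → Lin (A × B)
  pairBasis x y = ⟦ (x , y) ⟧

  ⊗-as-ext₂ : ∀ (u : Lin A) (v : Lin B) → u ⊗ v ∼ ext₂ pairBasis u v
  ⊗-as-ext₂ [] v = ∼-refl
  ⊗-as-ext₂ ((x , e) ∷ u) v = ∼-++ (row v) (⊗-as-ext₂ u v)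
    where
    row : ∀ v → map (λ { (y , b) → (x * y , (e , b)) }) v ∼ scale x (ext (λ y → ⟦ (e , y) ⟧) v)
    row [] = ∼-refl
    row ((y , b) ∷ v) = ∼-trans (∼-++ {u = (x * y , (e , b)) ∷ []} (∼-coef _ (*-congˡ (≈-sym (*-identityʳ y)))) (row v))
      (∼-reflexive (≡.sym (scale-++ x ((y * 1# , (e , b)) ∷ []) _)))

  ⊗-cong : ∀ {u u′ : Lin A} {v v′ : Lin B} → u ∼ u′ → v ∼ v′ → u ⊗ v ∼ u′ ⊗ v′
  ⊗-cong {u = u} {u′} {v} {v′} p q = ∼-trans (⊗-as-ext₂ u v) (∼-trans (ext₂-cong pairBasis p q) (∼-sym (⊗-as-ext₂ u′ v′)))

  ⊗-congˡ : ∀ {u u′ : Lin A} (v : Lin B) → u ∼ u′ → u ⊗ v ∼ u′ ⊗ v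
  ⊗-congˡ v p = ⊗-cong {v = v} p ∼-refl

  ⊗-congʳ : ∀ (u : Lin A) {v v′ : Lin B} → v ∼ v′ → u ⊗ v ∼ u ⊗ v′
  ⊗-congʳ u q = ⊗-cong {u = u} ∼-refl q

  ⊗-++ˡ : ∀ (u u′ : Lin A) (v : Lin B) → (u ++ u′) ⊗ v ≡ u ⊗ v ++ u′ ⊗ v
  ⊗-++ˡ u u′ v = concatMap-++ _ u u′

  ext-⊗-ext : ∀ (f : A′ → Lin A) (g : B′ → Lin B) u v → ext f u ⊗ ext g v ∼ ext₂ (λ x y → f x ⊗ g y) u v
  ext-⊗-ext f g u v = ∼-trans (⊗-as-ext₂ (ext f u) (ext g v)) (∼-trans (ext₂-ext pairBasis f g u v)
    (ext₂-pointwise u v (λ x y → ∼-sym (⊗-as-ext₂ (f x) (g y)))))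

  ⊗-basis : ∀ (x : A) (y : B) → ⟦ x ⟧ ⊗ ⟦ y ⟧ ∼ ⟦ (x , y) ⟧
  ⊗-basis x y = ∼-trans (⊗-as-ext₂ ⟦ x ⟧ ⟦ y ⟧) (ext₂-basis pairBasis x y)

  ⊗-basisˡ : ∀ (x : A) (v : Lin B) → ⟦ x ⟧ ⊗ v ∼ relabel (x ,_) v
  ⊗-basisˡ x v = ∼-trans (⊗-as-ext₂ ⟦ x ⟧ v) (∼-trans (ext₂-basisˡ pairBasis x v) (∼-sym (relabel-as-ext (x ,_) v)))

  ⊗-basisʳ : ∀ (u : Lin A) (y : B) → u ⊗ ⟦ y ⟧ ∼ relabel (_, y) u
  ⊗-basisʳ u y = ∼-trans (⊗-as-ext₂ u ⟦ y ⟧) (∼-trans (ext₂-basisʳ pairBasis u y) (∼-sym (relabel-as-ext (_, y) u)))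

  ext-⊗ : ∀ (F : A × B → Lin D) u v → ext F (u ⊗ v) ∼ ext₂ (λ x y → F (x , y)) u v
  ext-⊗ F u v = ∼-trans (ext-cong F (⊗-as-ext₂ u v))
    (∼-trans (ext-ext₂ F pairBasis u v) (ext₂-pointwise u v (λ x y → ext-basis F (x , y))))

  ext-basis-⊗ : ∀ (F : A × B → Lin D) x v → ext F (⟦ x ⟧ ⊗ v) ∼ ext (λ y → F (x , y)) v
  ext-basis-⊗ F x v = ∼-trans (ext-⊗ F ⟦ x ⟧ v) (ext₂-basisˡ (λ x y → F (x , y)) x v)

  ⊗-extˡ : ∀ (g : A′ → Lin A) u (v : Lin B) → ext g u ⊗ v ∼ ext (λ x → g x ⊗ v) u
  ⊗-extˡ g u v = ∼-trans (⊗-as-ext₂ (ext g u) v)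
    (∼-trans (ext₂-extˡ pairBasis g u v) (ext-pointwise u (λ x → ∼-sym (⊗-as-ext₂ (g x) v))))

  ⊗-extʳ : ∀ (u : Lin A) (g : B′ → Lin B) v → u ⊗ ext g v ∼ ext (λ y → u ⊗ g y) v
  ⊗-extʳ u g v = ∼-trans (⊗-as-ext₂ u (ext g v))
    (∼-trans (ext₂-extʳ pairBasis g u v) (ext-pointwise v (λ y → ∼-sym (⊗-as-ext₂ u (g y)))))

  relabel-⊗ˡ : ∀ (f : A → A′) (u : Lin A) (v : Lin B) → relabel (λ p → (f (proj₁ p) , proj₂ p)) (u ⊗ v) ≡ relabel f u ⊗ v
  relabel-⊗ˡ f [] v = refl
  relabel-⊗ˡ f ((x , w) ∷ u) v = ≡.trans (relabel-++ _ (map (λ { (y , b) → (x * y , (w , b)) }) v) (u ⊗ v))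
    (≡.cong₂ _++_ (row v) (relabel-⊗ˡ f u v))
    where
    row : ∀ v → relabel (λ p → (f (proj₁ p) , proj₂ p)) (map (λ { (y , b) → (x * y , (w , b)) }) v)
              ≡ map (λ { (y , b) → (x * y , (f w , b)) }) v
    row [] = refl
    row (z ∷ v) = ≡.cong (_ ∷_) (row v)

  relabel-⊗ : ∀ (g : A → A′) (u : Lin A) (v : Lin B) → relabel g u ⊗ v ∼ ext (λ x → ⟦ g x ⟧ ⊗ v) u
  relabel-⊗ g u v = ∼-trans (⊗-as-ext₂ (relabel g u) v) (∼-trans (ext₂-relabelˡ pairBasis g u v)
    (ext-pointwise u (λ x → ∼-trans (∼-sym (ext₂-basisˡ pairBasis (g x) v)) (∼-sym (⊗-as-ext₂ ⟦ g x ⟧ v)))))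

  concatMap-pointwise : ∀ {f g : A → Lin B} L → (∀ x → f x ∼ g x) → concatMap f L ∼ concatMap g L
  concatMap-pointwise [] e = ∼-refl
  concatMap-pointwise (x ∷ L) e = ∼-++ (e x) (concatMap-pointwise L e)

  concatMap-++ᶠ : ∀ (f g : A → Lin B) L → concatMap (λ x → f x ++ g x) L ∼ concatMap f L ++ concatMap g L
  concatMap-++ᶠ f g [] = ∼-refl
  concatMap-++ᶠ f g (x ∷ L) = ∼-trans (++-congˡ (f x ++ g x) (concatMap-++ᶠ f g L)) (++-interchange (f x) (g x) _ _)

  concatMap-empty : ∀ (L : List A) → concatMap {B = Carrier × B} (λ _ → []) L ≡ []
  concatMap-empty [] = refl
  concatMap-empty (x ∷ L) = concatMap-empty L

  concatMap-concatMap : ∀ (f : B → List D) (g : A → List B) L →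
                        concatMap f (concatMap g L) ≡ concatMap (λ x → concatMap f (g x)) L
  concatMap-concatMap f g [] = refl
  concatMap-concatMap f g (x ∷ L) =
    ≡.trans (concatMap-++ f (g x) (concatMap g L)) (≡.cong (concatMap f (g x) ++_) (concatMap-concatMap f g L))

  evalL-++ : ∀ (f : A → Carrier) u v → evalL f (u ++ v) ≈ evalL f u + evalL f v
  evalL-++ f [] v = ≈-sym (+-identityˡ _)
  evalL-++ f ((x , e) ∷ u) v = ≈-trans (+-congˡ (evalL-++ f u v)) (≈-sym (+-assoc _ _ _))

  evalL-scale : ∀ (f : A → Carrier) k u → evalL f (scale k u) ≈ k * evalL f u
  evalL-scale f k [] = ≈-sym (zeroʳ k)
  evalL-scale f k ((x , e) ∷ u) = ≈-trans (+-cong (*-assoc k x (f e)) (evalL-scale f k u)) (≈-sym (distribˡ k _ _))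

  evalL-pointwise : ∀ {f g : A → Carrier} u → (∀ e → f e ≈ g e) → evalL f u ≈ evalL g u
  evalL-pointwise [] h = ≈-refl
  evalL-pointwise ((x , e) ∷ u) h = +-cong (*-congˡ (h e)) (evalL-pointwise u h)

  evalL-*ʳ : ∀ (f : A → Carrier) k u → evalL (λ a → f a * k) u ≈ evalL f u * k
  evalL-*ʳ f k [] = ≈-sym (zeroˡ k)
  evalL-*ʳ f k ((x , e) ∷ u) = ≈-trans (+-cong (≈-sym (*-assoc x (f e) k)) (evalL-*ʳ f k u)) (≈-sym (distribʳ k _ _))

  evalL-zero : ∀ (u : Lin A) → evalL (λ _ → 0#) u ≈ 0#
  evalL-zero [] = ≈-refl
  evalL-zero ((x , e) ∷ u) = ≈-trans (+-cong (zeroʳ x) (evalL-zero u)) (+-identityˡ 0#)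

  evalL-ext : ∀ (f : B → Carrier) (g : A → Lin B) u → evalL f (ext g u) ≈ evalL (λ a → evalL f (g a)) u
  evalL-ext f g [] = ≈-refl
  evalL-ext f g ((x , e) ∷ u) = ≈-trans (evalL-++ f (scale x (g e)) (ext g u)) (+-cong (evalL-scale f x (g e)) (evalL-ext f g u))

  evalL-relabel : ∀ (f : B → Carrier) (h : A → B) u → evalL f (relabel h u) ≡ evalL (λ a → f (h a)) u
  evalL-relabel f h [] = refl
  evalL-relabel f h ((x , e) ∷ u) = ≡.cong (x * f (h e) +_) (evalL-relabel f h u)

  evalL-basis : ∀ (f : A → Carrier) e → evalL f ⟦ e ⟧ ≈ f e
  evalL-basis f e = ≈-trans (+-identityʳ _) (*-identityˡ (f e))

  ext-scale-evalL : ∀ (f : A → Carrier) (v : Lin B) u → ext (λ e → scale (f e) v) u ∼ scale (evalL f u) v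
  ext-scale-evalL f v [] = ∼-sym (scale-zeroˡ v)
  ext-scale-evalL f v ((x , e) ∷ u) = ∼-trans (∼-++ (scale-assoc x (f e) v) (ext-scale-evalL f v u)) (∼-sym (scale-+ _ _ v))

  data AllTerms {q} {B : Set b} (Q : B → Set q) : Lin B → Set (c ⊔ b ⊔ q) where
    []  : AllTerms Q []
    _∷_ : ∀ {k e X} → Q e → AllTerms Q X → AllTerms Q ((k , e) ∷ X)

  module _ {a q} {A : Set a} {Q : A → Set q} where

    AllTerms-++ : ∀ {u v} → AllTerms Q u → AllTerms Q v → AllTerms Q (u ++ v)
    AllTerms-++ [] qv = qv
    AllTerms-++ (q ∷ qu) qv = q ∷ AllTerms-++ qu qv

    AllTerms-concatMap : ∀ (f : A′ → Lin A) L → All (λ x → AllTerms Q (f x)) L → AllTerms Q (concatMap f L)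
    AllTerms-concatMap f [] [] = []
    AllTerms-concatMap f (x ∷ L) (q ∷ qs) = AllTerms-++ q (AllTerms-concatMap f L qs)

    ext-pointwise-on : ∀ {f g : A → Lin D} {u} → AllTerms Q u → (∀ e → Q e → f e ∼ g e) → ext f u ∼ ext g u
    ext-pointwise-on [] h = ∼-refl
    ext-pointwise-on (q ∷ qu) h = ∼-++ (scale-congʳ _ (h _ q)) (ext-pointwise-on qu h)

  AllTerms-relabel : ∀ {q q′} {Q : A → Set q} {Q′ : B → Set q′} (h : A → B) →
                     (∀ e → Q e → Q′ (h e)) → ∀ {u} → AllTerms Q u → AllTerms Q′ (relabel h u)
  AllTerms-relabel h f [] = []
  AllTerms-relabel h f (q ∷ qu) = f _ q ∷ AllTerms-relabel h f qu

  AllTerms-map : ∀ {q q′} {Q : B → Set q} {Q′ : B → Set q′} → (∀ e → Q e → Q′ e) → ∀ {u} → AllTerms Q u → AllTerms Q′ u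
  AllTerms-map f [] = []
  AllTerms-map f (q ∷ qu) = f _ q ∷ AllTerms-map f qu

  AllTerms-⊗ˡ : ∀ (x : A) (v : Lin B) → AllTerms (λ p → proj₁ p ≡ x) (⟦ x ⟧ ⊗ v)
  AllTerms-⊗ˡ x [] = []
  AllTerms-⊗ˡ x (_ ∷ v) = refl ∷ AllTerms-⊗ˡ x v

  -- Equality of basis elements need not be decidable, so the coefficient
  -- of a basis element is only available in the double-negation monad.
  module Coefficient {B : Set b} (e : B) where

    private
      return : ∀ {p} {P : Set p} → P → DoubleNegation P
      return x k = k x

      _>>=_ : ∀ {p q} {P : Set p} {Q : Set q} → DoubleNegation P → (P → DoubleNegation Q) → DoubleNegation Q
      (m >>= f) k = m (λ x → f x k)

    data CoefficientIs : Lin B → Carrier → Set (c ⊔ ℓ ⊔ b) where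
      nil  : CoefficientIs [] 0#
      hit  : ∀ {x u k} → CoefficientIs u k → CoefficientIs ((x , e) ∷ u) (x + k)
      miss : ∀ {x e′ u k} → ¬ (e′ ≡ e) → CoefficientIs u k → CoefficientIs ((x , e′) ∷ u) k

    private
      extend : ∀ {x e′ u k} → Dec (e′ ≡ e) → CoefficientIs u k → ∃ (CoefficientIs ((x , e′) ∷ u))
      extend (yes refl) c = _ , hit c
      extend (no e′≢e) c = _ , miss e′≢e c

    coefficient-exists : ∀ u → DoubleNegation (∃ (CoefficientIs u))
    coefficient-exists [] = return (0# , nil)
    coefficient-exists ((x , e′) ∷ u) = do
      (k , c) ← coefficient-exists u
      e′≟e ← ¬¬-excluded-middle
      return (extend e′≟e c)

    coefficient-unique : ∀ {u k k′} → CoefficientIs u k → CoefficientIs u k′ → k ≈ k′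
    coefficient-unique nil nil = ≈-refl
    coefficient-unique (hit p) (hit q) = +-congˡ (coefficient-unique p q)
    coefficient-unique (hit p) (miss n q) = ⊥-elim (n refl)
    coefficient-unique (miss n p) (hit q) = ⊥-elim (n refl)
    coefficient-unique (miss n p) (miss m q) = coefficient-unique p q

    coefficient-++ : ∀ u {v k} → CoefficientIs (u ++ v) k →
                     ∃₂ λ k₁ k₂ → CoefficientIs u k₁ × CoefficientIs v k₂ × k ≈ k₁ + k₂
    coefficient-++ [] c = 0# , _ , nil , c , ≈-sym (+-identityˡ _)
    coefficient-++ (_ ∷ u) (hit c) with coefficient-++ u c
    ... | k₁ , k₂ , c₁ , c₂ , eq = _ , k₂ , hit c₁ , c₂ , ≈-trans (+-congˡ eq) (≈-sym (+-assoc _ k₁ k₂))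
    coefficient-++ (_ ∷ u) (miss n c) with coefficient-++ u c
    ... | k₁ , k₂ , c₁ , c₂ , eq = k₁ , k₂ , miss n c₁ , c₂ , eq

    coefficient-swap : ∀ {x y u k} → CoefficientIs (x ∷ y ∷ u) k → ∃ λ k′ → CoefficientIs (y ∷ x ∷ u) k′ × k ≈ k′
    coefficient-swap (hit (hit c)) = _ , hit (hit c) , ≈-trans (≈-sym (+-assoc _ _ _)) (≈-trans (+-congʳ (+-comm _ _)) (+-assoc _ _ _))
    coefficient-swap (hit (miss n c)) = _ , miss n (hit c) , ≈-refl
    coefficient-swap (miss n (hit c)) = _ , hit (miss n c) , ≈-refl
    coefficient-swap (miss n (miss m c)) = _ , miss m (miss n c) , ≈-refl

    coefficient-resp-∼ : ∀ {u v k k′} → u ∼ v → CoefficientIs u k → CoefficientIs v k′ → DoubleNegation (k ≈ k′)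
    coefficient-resp-∼ ∼-refl p q = return (coefficient-unique p q)
    coefficient-resp-∼ (∼-sym r) p q = do
      k′≈k ← coefficient-resp-∼ r q p
      return (≈-sym k′≈k)
    coefficient-resp-∼ (∼-trans {v = w} r s) p q = do
      (_ , cw) ← coefficient-exists w
      eq₁ ← coefficient-resp-∼ r p cw
      eq₂ ← coefficient-resp-∼ s cw q
      return (≈-trans eq₁ eq₂)
    coefficient-resp-∼ (∼-++ {u} {u′} r s) p q with coefficient-++ u p | coefficient-++ u′ q
    ... | _ , _ , c₁ , c₂ , eq | _ , _ , c₁′ , c₂′ , eq′ = do
      eq₁ ← coefficient-resp-∼ r c₁ c₁′
      eq₂ ← coefficient-resp-∼ s c₂ c₂′
      return (≈-trans eq (≈-trans (+-cong eq₁ eq₂) (≈-sym eq′)))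
    coefficient-resp-∼ (∼-swap x y) p q with coefficient-swap p
    ... | _ , c , eq = return (≈-trans eq (coefficient-unique c q))
    coefficient-resp-∼ (∼-coef _ r) (hit nil) (hit nil) = return (+-congʳ r)
    coefficient-resp-∼ (∼-coef _ r) (hit nil) (miss n nil) = ⊥-elim (n refl)
    coefficient-resp-∼ (∼-coef _ r) (miss n nil) (hit nil) = ⊥-elim (n refl)
    coefficient-resp-∼ (∼-coef _ r) (miss n nil) (miss m nil) = return ≈-refl
    coefficient-resp-∼ (∼-merge x y _) (hit (hit nil)) (hit nil) = return (≈-trans (+-congˡ (+-identityʳ y)) (≈-sym (+-identityʳ (x + y))))
    coefficient-resp-∼ (∼-merge x y _) (hit (hit nil)) (miss n nil) = ⊥-elim (n refl)
    coefficient-resp-∼ (∼-merge x y _) (hit (miss n nil)) _ = ⊥-elim (n refl)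
    coefficient-resp-∼ (∼-merge x y _) (miss n (hit nil)) _ = ⊥-elim (n refl)
    coefficient-resp-∼ (∼-merge x y _) (miss n (miss m nil)) (hit nil) = ⊥-elim (n refl)
    coefficient-resp-∼ (∼-merge x y _) (miss n (miss m nil)) (miss _ nil) = return ≈-refl
    coefficient-resp-∼ (∼-zero _) (hit nil) nil = return (+-identityˡ 0#)
    coefficient-resp-∼ (∼-zero _) (miss n nil) nil = return ≈-refl

module QuasiShuffleBialgebra {c ℓ o} (K : Field c ℓ) (Ω : Set o) (_⊕_ : Ω → Ω → Ω) (isCS : IsCommutativeSemigroup _≡_ _⊕_) where

  open Field K renaming (refl to ≈-refl; sym to ≈-sym; trans to ≈-trans; reflexive to ≈-reflexive; setoid to K-setoid)
  open LinearAlgebra K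
  open QuasiShuffle K Ω _⊕_
    using ( Word; H; 𝟙; cons; sh; _⧢_; _⧢₂_; ‖_‖; compositions; shuffleAll; Γw; Γ; splits; Δw; Δ; ε; uε
          ; idᶠ; assocʳ; m₂₄τ; _⊗Idₖ; Idₖ⊗_; m[_⊗Id]; m[Id⊗_]; IsAntipode )
  open IsCommutativeSemigroup isCS using () renaming (assoc to ⊕-assoc; comm to ⊕-comm)

  -- The quasi-shuffle algebra

  sh-identityʳ : ∀ u → sh u [] ≡ ⟦ u ⟧
  sh-identityʳ [] = refl
  sh-identityʳ (a ∷ u) = refl

  cons-cong : ∀ a {X Y : H} → X ∼ Y → cons a X ∼ cons a Y
  cons-cong a = relabel-cong (a ∷_)

  cons-≡ : ∀ {a b} (X : H) → a ≡ b → cons a X ≡ cons b X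
  cons-≡ X refl = refl

  cons-ext : ∀ a (g : Word → H) X → cons a (ext g X) ≡ ext (λ t → cons a (g t)) X
  cons-ext a g X = relabel-ext (a ∷_) g X

  cons-ext-++ : ∀ a (g : Word → H) X Y → cons a (ext g (X ++ Y)) ≡ cons a (ext g X) ++ cons a (ext g Y)
  cons-ext-++ a g X Y = ≡.trans (≡.cong (cons a) (ext-++ g X Y)) (relabel-++ (a ∷_) (ext g X) (ext g Y))

  sh-comm : ∀ u v → sh u v ∼ sh v u
  sh-comm [] [] = ∼-refl
  sh-comm [] (b ∷ v) = ∼-refl
  sh-comm (a ∷ u) [] = ∼-refl
  sh-comm (a ∷ u) (b ∷ v) = ∼-trans
    (cons-cong a (sh-comm u (b ∷ v)) ⟨++⟩ cons-cong b (sh-comm (a ∷ u) v) ⟨++⟩ ∼-reflexive (cons-≡ (sh u v) (⊕-comm a b)))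
    (∼-trans (++-swapˡ (cons a (sh (b ∷ v) u)) (cons b (sh v (a ∷ u))) (cons (b ⊕ a) (sh u v)))
      (++-congˡ (cons b (sh v (a ∷ u))) (++-congˡ (cons a (sh (b ∷ v) u)) (cons-cong (b ⊕ a) (sh-comm u v)))))

  rightSh : Word → H → H
  rightSh w X = ext (λ t → sh t w) X

  leftSh : Word → H → H
  leftSh u X = ext (sh u) X

  rightSh-cons : ∀ a b w X →
    rightSh (b ∷ w) (cons a X) ∼ cons a (rightSh (b ∷ w) X) ++ (cons b (rightSh w (cons a X)) ++ cons (a ⊕ b) (rightSh w X))
  rightSh-cons a b w X = ∼-trans (∼-reflexive (ext-relabel (λ t → sh t (b ∷ w)) (a ∷_) X))
    (∼-trans (ext-++ᶠ (λ t → cons a (sh t (b ∷ w))) _ X)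
    (∼-trans (++-congˡ _ (ext-++ᶠ (λ t → cons b (sh (a ∷ t) w)) _ X))
    (∼-reflexive (≡.sym (≡.cong₂ _++_ (cons-ext a _ X) (≡.cong₂ _++_
       (≡.trans (≡.cong (cons b) (ext-relabel (λ t → sh t w) (a ∷_) X)) (cons-ext b _ X)) (cons-ext (a ⊕ b) _ X)))))))

  leftSh-cons : ∀ a u b X →
    leftSh (a ∷ u) (cons b X) ∼ cons a (leftSh u (cons b X)) ++ (cons b (leftSh (a ∷ u) X) ++ cons (a ⊕ b) (leftSh u X))
  leftSh-cons a u b X = ∼-trans (∼-reflexive (ext-relabel (sh (a ∷ u)) (b ∷_) X))
    (∼-trans (ext-++ᶠ (λ t → cons a (sh u (b ∷ t))) _ X)
    (∼-trans (++-congˡ _ (ext-++ᶠ (λ t → cons b (sh (a ∷ u) t)) _ X))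
    (∼-reflexive (≡.sym (≡.cong₂ _++_
       (≡.trans (≡.cong (cons a) (ext-relabel (sh u) (b ∷_) X)) (cons-ext a _ X))
       (≡.cong₂ _++_ (cons-ext b _ X) (cons-ext (a ⊕ b) _ X)))))))

  ShAssoc : Word → Word → Word → Set _
  ShAssoc u v w = rightSh w (sh u v) ∼ leftSh u (sh v w)

  -- One term for each nonempty set of first letters among a, b, c that is merged first.
  assocTerms : Ω → Word → Ω → Word → Ω → Word → H
  assocTerms a u b v c w =
    cons a (leftSh u (sh (b ∷ v) (c ∷ w))) ++ (cons b (leftSh (a ∷ u) (sh v (c ∷ w)))
    ++ (cons (a ⊕ b) (leftSh u (sh v (c ∷ w))) ++ (cons c (leftSh (a ∷ u) (sh (b ∷ v) w))
    ++ (cons (a ⊕ c) (leftSh u (sh (b ∷ v) w)) ++ (cons (b ⊕ c) (leftSh (a ∷ u) (sh v w))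
    ++ cons (a ⊕ (b ⊕ c)) (leftSh u (sh v w)))))))

  leftSh-sh-∷ : ∀ a u b v c w → leftSh (a ∷ u) (sh (b ∷ v) (c ∷ w)) ∼ assocTerms a u b v c w
  leftSh-sh-∷ a u b v c w =
    ∼-trans (∼-reflexive (≡.trans (ext-++ (sh (a ∷ u)) (cons b P) _) (≡.cong (leftSh (a ∷ u) (cons b P) ++_) (ext-++ (sh (a ∷ u)) (cons c Q) _))))
    (∼-trans (leftSh-cons a u b P ⟨++⟩ leftSh-cons a u c Q ⟨++⟩ leftSh-cons a u (b ⊕ c) R)
    (∼-trans (regroup (cons a (leftSh u (cons b P))) (cons b (leftSh (a ∷ u) P)) (cons (a ⊕ b) (leftSh u P))
                      (cons a (leftSh u (cons c Q))) (cons c (leftSh (a ∷ u) Q)) (cons (a ⊕ c) (leftSh u Q))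
                      (cons a (leftSh u (cons (b ⊕ c) R))) (cons (b ⊕ c) (leftSh (a ∷ u) R)) (cons (a ⊕ (b ⊕ c)) (leftSh u R)))
      (++-congʳ _ (∼-reflexive (≡.sym (≡.trans (cons-ext-++ a (sh u) (cons b P) _)
                                        (≡.cong (cons a (leftSh u (cons b P)) ++_) (cons-ext-++ a (sh u) (cons c Q) _))))))))
    where
    open ++-Solver Word using (solve; _⊜_) renaming (_⊕_ to _⊞_)
    P Q R : H
    P = sh v (c ∷ w)
    Q = sh (b ∷ v) w
    R = sh v w
    regroup : ∀ (a1 b1 e1 a2 c2 e2 a3 f3 g3 : H) →
      (a1 ++ (b1 ++ e1)) ++ ((a2 ++ (c2 ++ e2)) ++ (a3 ++ (f3 ++ g3))) ∼
      (a1 ++ (a2 ++ a3)) ++ (b1 ++ (e1 ++ (c2 ++ (e2 ++ (f3 ++ g3)))))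
    regroup = solve 9 (λ a1 b1 e1 a2 c2 e2 a3 f3 g3 →
      (a1 ⊞ (b1 ⊞ e1)) ⊞ ((a2 ⊞ (c2 ⊞ e2)) ⊞ (a3 ⊞ (f3 ⊞ g3))) ⊜
      (a1 ⊞ (a2 ⊞ a3)) ⊞ (b1 ⊞ (e1 ⊞ (c2 ⊞ (e2 ⊞ (f3 ⊞ g3)))))) ∼-refl

  rightSh-sh-∷ : ∀ a u b v c w →
    ShAssoc u (b ∷ v) (c ∷ w) → ShAssoc (a ∷ u) v (c ∷ w) → ShAssoc u v (c ∷ w) → ShAssoc (a ∷ u) (b ∷ v) w →
    ShAssoc u (b ∷ v) w → ShAssoc (a ∷ u) v w → ShAssoc u v w →
    rightSh (c ∷ w) (sh (a ∷ u) (b ∷ v)) ∼ assocTerms a u b v c w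
  rightSh-sh-∷ a u b v c w i1 i2 i3 i4 i5 i6 i7 =
    ∼-trans (∼-reflexive (≡.trans (ext-++ (λ t → sh t (c ∷ w)) (cons a P) _) (≡.cong (rightSh (c ∷ w) (cons a P) ++_) (ext-++ (λ t → sh t (c ∷ w)) (cons b Q) _))))
    (∼-trans (rightSh-cons a c w P ⟨++⟩ rightSh-cons b c w Q ⟨++⟩ rightSh-cons (a ⊕ b) c w R)
    (∼-trans (regroup (cons a (rightSh (c ∷ w) P)) (cons c (rightSh w (cons a P))) (cons (a ⊕ c) (rightSh w P))
                      (cons b (rightSh (c ∷ w) Q)) (cons c (rightSh w (cons b Q))) (cons (b ⊕ c) (rightSh w Q))
                      (cons (a ⊕ b) (rightSh (c ∷ w) R)) (cons c (rightSh w (cons (a ⊕ b) R))) (cons ((a ⊕ b) ⊕ c) (rightSh w R)))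
      (cons-cong a i1 ⟨++⟩ cons-cong b i2 ⟨++⟩ cons-cong (a ⊕ b) i3
       ⟨++⟩ ∼-trans (∼-reflexive (≡.sym (≡.trans (cons-ext-++ c (λ t → sh t w) (cons a P) _)
                                          (≡.cong (cons c (rightSh w (cons a P)) ++_) (cons-ext-++ c (λ t → sh t w) (cons b Q) _)))))
                    (cons-cong c i4)
       ⟨++⟩ cons-cong (a ⊕ c) i5 ⟨++⟩ cons-cong (b ⊕ c) i6
       ⟨++⟩ ∼-trans (∼-reflexive (cons-≡ (rightSh w R) (⊕-assoc a b c))) (cons-cong (a ⊕ (b ⊕ c)) i7))))
    where
    open ++-Solver Word using (solve; _⊜_) renaming (_⊕_ to _⊞_)
    P Q R : H
    P = sh u (b ∷ v)
    Q = sh (a ∷ u) v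
    R = sh u v
    regroup : ∀ (a1 c1 d1 a2 c2 d2 a3 c3 d3 : H) →
      (a1 ++ (c1 ++ d1)) ++ ((a2 ++ (c2 ++ d2)) ++ (a3 ++ (c3 ++ d3))) ∼
      a1 ++ (a2 ++ (a3 ++ ((c1 ++ (c2 ++ c3)) ++ (d1 ++ (d2 ++ d3)))))
    regroup = solve 9 (λ a1 c1 d1 a2 c2 d2 a3 c3 d3 →
      (a1 ⊞ (c1 ⊞ d1)) ⊞ ((a2 ⊞ (c2 ⊞ d2)) ⊞ (a3 ⊞ (c3 ⊞ d3))) ⊜
      a1 ⊞ (a2 ⊞ (a3 ⊞ ((c1 ⊞ (c2 ⊞ c3)) ⊞ (d1 ⊞ (d2 ⊞ d3)))))) ∼-refl

  sh-assoc : ∀ u v w → ShAssoc u v w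
  sh-assoc [] v w = ∼-trans (ext-basis (λ t → sh t w) v) (∼-sym (ext-⟦⟧ (sh v w)))
  sh-assoc (a ∷ u) [] w = ∼-trans (ext-basis (λ t → sh t w) (a ∷ u)) (∼-sym (ext-basis (sh (a ∷ u)) w))
  sh-assoc (a ∷ u) (b ∷ v) [] = ∼-trans (ext-pointwise (sh (a ∷ u) (b ∷ v)) (λ t → ∼-reflexive (sh-identityʳ t)))
    (∼-trans (ext-⟦⟧ _) (∼-sym (ext-basis (sh (a ∷ u)) (b ∷ v))))
  sh-assoc (a ∷ u) (b ∷ v) (c ∷ w) = ∼-trans
    (rightSh-sh-∷ a u b v c w
      (sh-assoc u (b ∷ v) (c ∷ w)) (sh-assoc (a ∷ u) v (c ∷ w)) (sh-assoc u v (c ∷ w)) (sh-assoc (a ∷ u) (b ∷ v) w)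
      (sh-assoc u (b ∷ v) w) (sh-assoc (a ∷ u) v w) (sh-assoc u v w))
    (∼-sym (leftSh-sh-∷ a u b v c w))

  ⧢-cong : ∀ {u u′ v v′} → u ∼ u′ → v ∼ v′ → u ⧢ v ∼ u′ ⧢ v′
  ⧢-cong = ext₂-cong sh

  ⧢-congˡ : ∀ {u u′} v → u ∼ u′ → u ⧢ v ∼ u′ ⧢ v
  ⧢-congˡ v p = ⧢-cong {v = v} p ∼-refl

  ⧢-congʳ : ∀ u {v v′} → v ∼ v′ → u ⧢ v ∼ u ⧢ v′
  ⧢-congʳ u q = ⧢-cong {u = u} ∼-refl q

  ⧢-basis : ∀ u v → ⟦ u ⟧ ⧢ ⟦ v ⟧ ∼ sh u v
  ⧢-basis = ext₂-basis sh

  ⧢-comm : ∀ u v → u ⧢ v ∼ v ⧢ u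
  ⧢-comm = ext₂-comm sh sh-comm

  ⧢-assoc : ∀ u v w → (u ⧢ v) ⧢ w ∼ u ⧢ (v ⧢ w)
  ⧢-assoc = ext₂-assoc sh sh-assoc

  ⧢-identityˡ : ∀ u → 𝟙 ⧢ u ∼ u
  ⧢-identityˡ u = ∼-trans (ext₂-basisˡ sh [] u) (ext-⟦⟧ u)

  ⧢-identityʳ : ∀ u → u ⧢ 𝟙 ∼ u
  ⧢-identityʳ u = ∼-trans (ext₂-basisʳ sh u []) (∼-trans (ext-pointwise u (λ t → ∼-reflexive (sh-identityʳ t))) (ext-⟦⟧ u))

  ⧢-commutativeMonoid : CommutativeMonoid _ _
  ⧢-commutativeMonoid = record
    { Carrier = H ; _≈_ = _∼_ ; _∙_ = _⧢_ ; ε = 𝟙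
    ; isCommutativeMonoid = record
      { isMonoid = record
        { isSemigroup = record
          { isMagma = record { isEquivalence = ∼-isEquivalence ; ∙-cong = ⧢-cong }
          ; assoc = ⧢-assoc }
        ; identity = ⧢-identityˡ , ⧢-identityʳ }
      ; comm = ⧢-comm } }

  H₂ : Set _
  H₂ = Lin (Word × Word)

  𝟙₂ : H₂
  𝟙₂ = ⟦ ([] , []) ⟧

  sh₂ : Word × Word → Word × Word → H₂
  sh₂ x y = sh (proj₁ x) (proj₁ y) ⊗ sh (proj₂ x) (proj₂ y)

  ⧢₂-cong : ∀ {X X′ Y Y′} → X ∼ X′ → Y ∼ Y′ → X ⧢₂ Y ∼ X′ ⧢₂ Y′
  ⧢₂-cong = ext₂-cong sh₂

  ⧢₂-congˡ : ∀ {X X′} Y → X ∼ X′ → X ⧢₂ Y ∼ X′ ⧢₂ Y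
  ⧢₂-congˡ Y p = ⧢₂-cong {Y = Y} p ∼-refl

  ⧢₂-congʳ : ∀ X {Y Y′} → Y ∼ Y′ → X ⧢₂ Y ∼ X ⧢₂ Y′
  ⧢₂-congʳ X q = ⧢₂-cong {X = X} ∼-refl q

  ⧢₂-⊗ : ∀ (X Y X′ Y′ : H) → (X ⊗ Y) ⧢₂ (X′ ⊗ Y′) ∼ (X ⧢ X′) ⊗ (Y ⧢ Y′)
  ⧢₂-⊗ X Y X′ Y′ = ∼-trans (⧢₂-cong (⊗-as-ext₂ X Y) (⊗-as-ext₂ X′ Y′))
    (∼-trans (ext₂-ext sh₂ (λ x → ext (pairBasis x) Y) (λ x′ → ext (pairBasis x′) Y′) X X′)
    (∼-trans (ext₂-pointwise X X′ (λ x x′ → ∼-trans (ext₂-ext sh₂ (pairBasis x) (pairBasis x′) Y Y′)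
          (ext₂-pointwise Y Y′ (λ y y′ → ext₂-basis sh₂ (x , y) (x′ , y′)))))
    (∼-trans (ext-pointwise X (λ x → ext-comm (λ x′ y → ext (λ y′ → sh x x′ ⊗ sh y y′) Y′) X′ Y))
    (∼-sym (∼-trans (ext-⊗-ext (λ x → ext (sh x) X′) (λ y → ext (sh y) Y′) X Y)
       (ext₂-pointwise X Y (λ x y → ext-⊗-ext (sh x) (sh y) X′ Y′)))))))

  ⟦⟧-⊗ : ∀ (x : Word × Word) → ⟦ x ⟧ ∼ ⟦ proj₁ x ⟧ ⊗ ⟦ proj₂ x ⟧
  ⟦⟧-⊗ x = ∼-sym (⊗-basis (proj₁ x) (proj₂ x))

  ⧢₂-basis : ∀ x y → ⟦ x ⟧ ⧢₂ ⟦ y ⟧ ∼ sh₂ x y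
  ⧢₂-basis = ext₂-basis sh₂

  ⊗-⧢₂-basis : ∀ (c′ : Ω) W (X : H) B Z → (⟦ c′ ∷ W ⟧ ⊗ X) ⧢₂ ⟦ (B , Z) ⟧ ∼ sh (c′ ∷ W) B ⊗ (X ⧢ ⟦ Z ⟧)
  ⊗-⧢₂-basis c′ W X B Z = ∼-trans (⧢₂-congʳ (⟦ c′ ∷ W ⟧ ⊗ X) (⟦⟧-⊗ (B , Z)))
    (∼-trans (⧢₂-⊗ ⟦ c′ ∷ W ⟧ X ⟦ B ⟧ ⟦ Z ⟧) (⊗-congˡ (X ⧢ ⟦ Z ⟧) (⧢-basis (c′ ∷ W) B)))

  ⧢₂-identityˡ : ∀ X → 𝟙₂ ⧢₂ X ∼ X
  ⧢₂-identityˡ X = ∼-trans (ext₂-basisˡ sh₂ ([] , []) X) (∼-trans (ext-pointwise X (λ y → ⊗-basis (proj₁ y) (proj₂ y))) (ext-⟦⟧ X))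

  ⧢₂-identityʳ : ∀ X → X ⧢₂ 𝟙₂ ∼ X
  ⧢₂-identityʳ X = ∼-trans (ext₂-basisʳ sh₂ X ([] , []))
    (∼-trans (ext-pointwise X (λ y → ∼-trans (∼-reflexive (≡.cong₂ _⊗_ (sh-identityʳ (proj₁ y)) (sh-identityʳ (proj₂ y))))
                                             (⊗-basis (proj₁ y) (proj₂ y))))
    (ext-⟦⟧ X))

  sh₂-assoc : ∀ x y z → ext (λ w → sh₂ w z) (sh₂ x y) ∼ ext (sh₂ x) (sh₂ y z)
  sh₂-assoc (x₁ , x₂) (y₁ , y₂) (z₁ , z₂) =
    ∼-trans (∼-sym (ext₂-basisʳ sh₂ (sh₂ (x₁ , x₂) (y₁ , y₂)) (z₁ , z₂)))
    (∼-trans (⧢₂-congʳ (sh₂ (x₁ , x₂) (y₁ , y₂)) (⟦⟧-⊗ (z₁ , z₂)))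
    (∼-trans (⧢₂-⊗ (sh x₁ y₁) (sh x₂ y₂) ⟦ z₁ ⟧ ⟦ z₂ ⟧)
    (∼-trans (⊗-cong (∼-trans (ext₂-basisʳ sh (sh x₁ y₁) z₁) (sh-assoc x₁ y₁ z₁))
                     (∼-trans (ext₂-basisʳ sh (sh x₂ y₂) z₂) (sh-assoc x₂ y₂ z₂)))
    (∼-sym (∼-trans (∼-sym (ext₂-basisˡ sh₂ (x₁ , x₂) (sh₂ (y₁ , y₂) (z₁ , z₂))))
    (∼-trans (⧢₂-congˡ (sh₂ (y₁ , y₂) (z₁ , z₂)) (⟦⟧-⊗ (x₁ , x₂)))
    (∼-trans (⧢₂-⊗ ⟦ x₁ ⟧ ⟦ x₂ ⟧ (sh y₁ z₁) (sh y₂ z₂))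
    (⊗-cong (ext₂-basisˡ sh x₁ (sh y₁ z₁)) (ext₂-basisˡ sh x₂ (sh y₂ z₂))))))))))

  ⧢₂-assoc : ∀ X Y Z → (X ⧢₂ Y) ⧢₂ Z ∼ X ⧢₂ (Y ⧢₂ Z)
  ⧢₂-assoc = ext₂-assoc sh₂ sh₂-assoc

  -- Deconcatenation

  consˡ : Ω → H₂ → H₂
  consˡ a = relabel (λ p → (a ∷ proj₁ p , proj₂ p))

  𝟙⊗ : H → H₂
  𝟙⊗ = relabel (λ t → ([] , t))

  consˡ-⊗ : ∀ a (X Z : H) → consˡ a (X ⊗ Z) ≡ cons a X ⊗ Z
  consˡ-⊗ a = relabel-⊗ˡ (a ∷_)

  Δw-∷ : ∀ a u → Δw (a ∷ u) ≡ ⟦ ([] , a ∷ u) ⟧ ++ consˡ a (Δw u)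
  Δw-∷ a u = ≡.cong (_ ∷_) (go (splits u))
    where
    go : ∀ (L : List (Word × Word)) → map (λ s → (1# , s)) (map (λ { (u , v) → (a ∷ u , v) }) L) ≡ consˡ a (map (λ s → (1# , s)) L)
    go [] = refl
    go (x ∷ L) = ≡.cong (_ ∷_) (go L)

  Δ-cons : ∀ a X → Δ (cons a X) ∼ 𝟙⊗ (cons a X) ++ consˡ a (Δ X)
  Δ-cons a X = ∼-trans (∼-reflexive (ext-relabel Δw (a ∷_) X))
    (∼-trans (ext-pointwise X (λ t → ∼-reflexive (Δw-∷ a t)))
    (∼-trans (ext-++ᶠ (λ t → ⟦ ([] , a ∷ t) ⟧) (λ t → consˡ a (Δw t)) X)
    (∼-++ (∼-trans (∼-sym (relabel-as-ext (λ t → ([] , a ∷ t)) X)) (∼-reflexive (≡.sym (relabel-relabel _ (a ∷_) X))))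
          (∼-reflexive (≡.sym (relabel-ext _ Δw X))))))

  𝟙⊗-⧢₂-𝟙⊗ : ∀ u v → ⟦ ([] , u) ⟧ ⧢₂ ⟦ ([] , v) ⟧ ∼ 𝟙⊗ (sh u v)
  𝟙⊗-⧢₂-𝟙⊗ u v = ∼-trans (⧢₂-basis ([] , u) ([] , v)) (⊗-basisˡ [] (sh u v))

  𝟙⊗-⧢₂-consˡ : ∀ b u Y → ⟦ ([] , u) ⟧ ⧢₂ consˡ b Y ∼ consˡ b (⟦ ([] , u) ⟧ ⧢₂ Y)
  𝟙⊗-⧢₂-consˡ b u Y = ∼-trans (ext₂-basisˡ sh₂ ([] , u) (consˡ b Y))
    (∼-trans (∼-reflexive (ext-relabel (sh₂ ([] , u)) _ Y))
    (∼-sym (∼-trans (relabel-cong _ (ext₂-basisˡ sh₂ ([] , u) Y))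
    (∼-trans (∼-reflexive (relabel-ext _ (sh₂ ([] , u)) Y))
    (ext-pointwise Y (λ y → ∼-reflexive (consˡ-⊗ b ⟦ proj₁ y ⟧ (sh u (proj₂ y)))))))))

  consˡ-⧢₂-𝟙⊗ : ∀ a X v → consˡ a X ⧢₂ ⟦ ([] , v) ⟧ ∼ consˡ a (X ⧢₂ ⟦ ([] , v) ⟧)
  consˡ-⧢₂-𝟙⊗ a X v = ∼-trans (ext₂-basisʳ sh₂ (consˡ a X) ([] , v))
    (∼-trans (∼-reflexive (ext-relabel (λ x → sh₂ x ([] , v)) _ X))
    (∼-sym (∼-trans (relabel-cong _ (ext₂-basisʳ sh₂ X ([] , v)))
    (∼-trans (∼-reflexive (relabel-ext _ (λ x → sh₂ x ([] , v)) X))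
    (ext-pointwise X (λ x → ∼-reflexive (≡.trans (≡.cong (λ k → consˡ a (k ⊗ sh (proj₂ x) v)) (sh-identityʳ (proj₁ x)))
                                                  (consˡ-⊗ a ⟦ proj₁ x ⟧ (sh (proj₂ x) v)))))))))

  consˡ-⧢₂-consˡ : ∀ a b X Y →
    consˡ a X ⧢₂ consˡ b Y ∼ consˡ a (X ⧢₂ consˡ b Y) ++ (consˡ b (consˡ a X ⧢₂ Y) ++ consˡ (a ⊕ b) (X ⧢₂ Y))
  consˡ-⧢₂-consˡ a b X Y = ∼-trans (ext₂-relabel sh₂ _ _ X Y)
    (∼-trans (ext₂-pointwise X Y first-factor-recursion)
    (∼-trans (ext₂-++ᶠ k₁ (λ x y → k₂ x y ++ k₃ x y) X Y)
    (∼-trans (++-congˡ (ext₂ k₁ X Y) (ext₂-++ᶠ k₂ k₃ X Y))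
    (∼-sym (∼-trans (relabel-ext₂ _ sh₂ X (consˡ b Y)) (ext₂-relabelʳ _ _ X Y)
       ⟨++⟩ ∼-trans (relabel-ext₂ _ sh₂ (consˡ a X) Y) (ext₂-relabelˡ _ _ X Y)
       ⟨++⟩ relabel-ext₂ _ sh₂ X Y)))))
    where
    k₁ k₂ k₃ : Word × Word → Word × Word → H₂
    k₁ x y = consˡ a (sh (proj₁ x) (b ∷ proj₁ y) ⊗ sh (proj₂ x) (proj₂ y))
    k₂ x y = consˡ b (sh (a ∷ proj₁ x) (proj₁ y) ⊗ sh (proj₂ x) (proj₂ y))
    k₃ x y = consˡ (a ⊕ b) (sh (proj₁ x) (proj₁ y) ⊗ sh (proj₂ x) (proj₂ y))
    first-factor-recursion : ∀ x y → sh₂ (a ∷ proj₁ x , proj₂ x) (b ∷ proj₁ y , proj₂ y) ∼ k₁ x y ++ (k₂ x y ++ k₃ x y)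
    first-factor-recursion (x₁ , x₂) (y₁ , y₂) = ∼-reflexive (begin
      (cons a (sh x₁ (b ∷ y₁)) ++ (cons b (sh (a ∷ x₁) y₁) ++ cons (a ⊕ b) (sh x₁ y₁))) ⊗ sh x₂ y₂
        ≡⟨ ⊗-++ˡ (cons a (sh x₁ (b ∷ y₁))) _ (sh x₂ y₂) ⟩
      cons a (sh x₁ (b ∷ y₁)) ⊗ sh x₂ y₂ ++ (cons b (sh (a ∷ x₁) y₁) ++ cons (a ⊕ b) (sh x₁ y₁)) ⊗ sh x₂ y₂
        ≡⟨ ≡.cong (cons a (sh x₁ (b ∷ y₁)) ⊗ sh x₂ y₂ ++_) (⊗-++ˡ (cons b (sh (a ∷ x₁) y₁)) _ (sh x₂ y₂)) ⟩
      cons a (sh x₁ (b ∷ y₁)) ⊗ sh x₂ y₂ ++ (cons b (sh (a ∷ x₁) y₁) ⊗ sh x₂ y₂ ++ cons (a ⊕ b) (sh x₁ y₁) ⊗ sh x₂ y₂)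
        ≡⟨ ≡.sym (≡.cong₂ _++_ (consˡ-⊗ a (sh x₁ (b ∷ y₁)) (sh x₂ y₂))
                           (≡.cong₂ _++_ (consˡ-⊗ b (sh (a ∷ x₁) y₁) (sh x₂ y₂)) (consˡ-⊗ (a ⊕ b) (sh x₁ y₁) (sh x₂ y₂)))) ⟩
      k₁ (x₁ , x₂) (y₁ , y₂) ++ (k₂ (x₁ , x₂) (y₁ , y₂) ++ k₃ (x₁ , x₂) (y₁ , y₂)) ∎)
      where open ≡.≡-Reasoning

  Δ-Multiplicative : Word → Word → Set _
  Δ-Multiplicative u v = Δ (sh u v) ∼ Δw u ⧢₂ Δw v

  deconcatTerms : Ω → Word → Ω → Word → H₂
  deconcatTerms a u b v =
    (𝟙⊗ (sh (a ∷ u) (b ∷ v)) ++ consˡ b (⟦ ([] , a ∷ u) ⟧ ⧢₂ Δw v))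
    ++ (consˡ a (Δw u ⧢₂ ⟦ ([] , b ∷ v) ⟧) ++ (consˡ a (Δw u ⧢₂ consˡ b (Δw v))
    ++ (consˡ b (consˡ a (Δw u) ⧢₂ Δw v) ++ consˡ (a ⊕ b) (Δw u ⧢₂ Δw v))))

  Δw-⧢₂-Δw : ∀ a u b v → Δw (a ∷ u) ⧢₂ Δw (b ∷ v) ∼ deconcatTerms a u b v
  Δw-⧢₂-Δw a u b v = ∼-trans (∼-reflexive (≡.cong₂ _⧢₂_ (Δw-∷ a u) (Δw-∷ b v)))
    (∼-trans (∼-reflexive (ext₂-++ˡ sh₂ Eu (consˡ a (Δw u)) (Ev ++ consˡ b (Δw v))))
    (∼-trans (ext₂-++ʳ sh₂ Eu Ev (consˡ b (Δw v))) (𝟙⊗-⧢₂-𝟙⊗ (a ∷ u) (b ∷ v) ⟨++⟩ 𝟙⊗-⧢₂-consˡ b (a ∷ u) (Δw v))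
     ⟨++⟩ ∼-trans (ext₂-++ʳ sh₂ (consˡ a (Δw u)) Ev (consˡ b (Δw v))) (consˡ-⧢₂-𝟙⊗ a (Δw u) (b ∷ v) ⟨++⟩ consˡ-⧢₂-consˡ a b (Δw u) (Δw v))))
    where
    Eu Ev : H₂
    Eu = ⟦ ([] , a ∷ u) ⟧
    Ev = ⟦ ([] , b ∷ v) ⟧

  Δ-sh-∷ : ∀ a u b v → Δ-Multiplicative u (b ∷ v) → Δ-Multiplicative (a ∷ u) v → Δ-Multiplicative u v →
           Δ (sh (a ∷ u) (b ∷ v)) ∼ deconcatTerms a u b v
  Δ-sh-∷ a u b v i1 i2 i3 =
    ∼-trans (∼-reflexive (≡.trans (ext-++ Δw (cons a P) _) (≡.cong (Δ (cons a P) ++_) (ext-++ Δw (cons b Q) _))))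
    (∼-trans (Δ-cons a P ⟨++⟩ Δ-cons b Q ⟨++⟩ Δ-cons (a ⊕ b) R)
    (∼-trans (regroup₁ (𝟙⊗ (cons a P)) _ (𝟙⊗ (cons b Q)) _ (𝟙⊗ (cons (a ⊕ b) R)) _)
    (∼-trans (∼-reflexive (≡.sym (≡.trans (relabel-++ _ (cons a P) _) (≡.cong (𝟙⊗ (cons a P) ++_) (relabel-++ _ (cons b Q) _))))
              ⟨++⟩ (relabel-cong _ (∼-trans i1 (∼-trans (⧢₂-congʳ Du (∼-reflexive (Δw-∷ b v))) (ext₂-++ʳ sh₂ Du Ev (consˡ b Dv))))
                    ⟨++⟩ relabel-cong _ (∼-trans i2 (∼-reflexive (≡.trans (≡.cong (_⧢₂ Dv) (Δw-∷ a u)) (ext₂-++ˡ sh₂ Eu (consˡ a Du) Dv))))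
                    ⟨++⟩ relabel-cong _ i3))
    (∼-trans (++-congˡ (𝟙⊗ (sh (a ∷ u) (b ∷ v)))
               (∼-reflexive (≡.cong₂ _++_ (relabel-++ _ (Du ⧢₂ Ev) _) (≡.cong (_++ consˡ (a ⊕ b) (Du ⧢₂ Dv)) (relabel-++ _ (Eu ⧢₂ Dv) (consˡ a Du ⧢₂ Dv))))))
    (regroup₂ (𝟙⊗ (sh (a ∷ u) (b ∷ v))) (consˡ a (Du ⧢₂ Ev)) (consˡ a (Du ⧢₂ consˡ b Dv))
              (consˡ b (Eu ⧢₂ Dv)) (consˡ b (consˡ a Du ⧢₂ Dv)) (consˡ (a ⊕ b) (Du ⧢₂ Dv)))))))
    where
    open ++-Solver (Word × Word) using (solve; _⊜_) renaming (_⊕_ to _⊞_)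
    P Q R : H
    P = sh u (b ∷ v)
    Q = sh (a ∷ u) v
    R = sh u v
    Du Dv Eu Ev : H₂
    Du = Δw u
    Dv = Δw v
    Eu = ⟦ ([] , a ∷ u) ⟧
    Ev = ⟦ ([] , b ∷ v) ⟧
    regroup₁ : ∀ (e1 c1 e2 c2 e3 c3 : H₂) →
      (e1 ++ c1) ++ ((e2 ++ c2) ++ (e3 ++ c3)) ∼ (e1 ++ (e2 ++ e3)) ++ (c1 ++ (c2 ++ c3))
    regroup₁ = solve 6 (λ e1 c1 e2 c2 e3 c3 →
      (e1 ⊞ c1) ⊞ ((e2 ⊞ c2) ⊞ (e3 ⊞ c3)) ⊜ (e1 ⊞ (e2 ⊞ e3)) ⊞ (c1 ⊞ (c2 ⊞ c3))) ∼-refl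
    regroup₂ : ∀ (t0 t1 t2 t3 t4 t5 : H₂) →
      t0 ++ ((t1 ++ t2) ++ ((t3 ++ t4) ++ t5)) ∼ (t0 ++ t3) ++ (t1 ++ (t2 ++ (t4 ++ t5)))
    regroup₂ = solve 6 (λ t0 t1 t2 t3 t4 t5 →
      t0 ⊞ ((t1 ⊞ t2) ⊞ ((t3 ⊞ t4) ⊞ t5)) ⊜ (t0 ⊞ t3) ⊞ (t1 ⊞ (t2 ⊞ (t4 ⊞ t5)))) ∼-refl

  Δw-sh : ∀ u v → Δ-Multiplicative u v
  Δw-sh [] v = ∼-trans (ext-basis Δw v) (∼-sym (⧢₂-identityˡ (Δw v)))
  Δw-sh (a ∷ u) [] = ∼-trans (ext-basis Δw (a ∷ u)) (∼-sym (⧢₂-identityʳ (Δw (a ∷ u))))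
  Δw-sh (a ∷ u) (b ∷ v) =
    ∼-trans (Δ-sh-∷ a u b v (Δw-sh u (b ∷ v)) (Δw-sh (a ∷ u) v) (Δw-sh u v)) (∼-sym (Δw-⧢₂-Δw a u b v))

  ext-Δw : ∀ {b} {B : Set b} (F : Word × Word → Lin B) w → ext F (Δw w) ∼ concatMap F (splits w)
  ext-Δw F w = ∼-trans (∼-reflexive (concatMap-map _ _ (splits w))) (concatMap-pointwise (splits w) (λ s → scale-identityˡ (F s)))

  ext-Δw-∷ : ∀ {b} {B : Set b} (F : Word × Word → Lin B) y u →
    ext F (Δw (y ∷ u)) ∼ F ([] , y ∷ u) ++ ext (λ s → F (y ∷ proj₁ s , proj₂ s)) (Δw u)
  ext-Δw-∷ F y u = ∼-trans (∼-reflexive (≡.trans (≡.cong (ext F) (Δw-∷ y u)) (ext-++ F ⟦ ([] , y ∷ u) ⟧ (consˡ y (Δw u)))))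
    (∼-++ (ext-basis F ([] , y ∷ u)) (∼-reflexive (ext-relabel F _ (Δw u))))

  ext-Δw-first : ∀ {b} {B : Set b} (F : Word × Word → Lin B) w {X} →
    F ([] , w) ∼ X → (∀ y p q → F (y ∷ p , q) ∼ []) → ext F (Δw w) ∼ X
  ext-Δw-first F [] h0 h1 = ∼-trans (ext-basis F ([] , [])) h0
  ext-Δw-first F (y ∷ u) {X} h0 h1 = ∼-trans (ext-Δw-∷ F y u)
    (∼-trans (∼-++ h0 (ext-zero (Δw u) (λ s → h1 y (proj₁ s) (proj₂ s)))) (∼-reflexive (++-identityʳ X)))

  ext-Δw-last : ∀ {b} {B : Set b} (F : Word × Word → Lin B) (G : Word → Lin B) w →
    (∀ p → F (p , []) ∼ G p) → (∀ p y q → F (p , y ∷ q) ∼ []) → ext F (Δw w) ∼ G w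
  ext-Δw-last F G [] h0 h1 = ∼-trans (ext-basis F ([] , [])) (h0 [])
  ext-Δw-last F G (y ∷ u) h0 h1 = ∼-trans (ext-Δw-∷ F y u)
    (∼-++ {u′ = []} (h1 [] y u) (ext-Δw-last (λ s → F (y ∷ proj₁ s , proj₂ s)) (λ p → G (y ∷ p)) u (λ p → h0 (y ∷ p)) (λ p → h1 (y ∷ p))))

  Δw-coassoc : ∀ {b} {B : Set b} (F : Word → Word → Word → Lin B) w →
    ext (λ s → ext (λ t → F (proj₁ t) (proj₂ t) (proj₂ s)) (Δw (proj₁ s))) (Δw w) ∼
    ext (λ s → ext (λ t → F (proj₁ s) (proj₁ t) (proj₂ t)) (Δw (proj₂ s))) (Δw w)
  Δw-coassoc F [] = ∼-refl
  Δw-coassoc F (y ∷ u) =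
    ∼-trans (ext-Δw-∷ _ y u)
    (∼-trans (∼-++ (ext-basis (λ t → F (proj₁ t) (proj₂ t) (y ∷ u)) ([] , []))
                   (∼-trans (ext-pointwise (Δw u) (λ s → ext-Δw-∷ (λ t → F (proj₁ t) (proj₂ t) (proj₂ s)) y (proj₁ s)))
                            (ext-++ᶠ (λ s → F [] (y ∷ proj₁ s) (proj₂ s)) _ (Δw u))))
    (∼-trans (∼-reflexive (≡.sym (++-assoc (F [] [] (y ∷ u)) _ _)))
    (∼-sym (∼-trans (ext-Δw-∷ _ y u)
      (∼-++ (ext-Δw-∷ (λ t → F [] (proj₁ t) (proj₂ t)) y u)
            (∼-sym (Δw-coassoc (λ p r q → F (y ∷ p) r q) u)))))))

  AllSuffixes : ∀ {p} → (Word → Set p) → Word → Set p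
  AllSuffixes P [] = P []
  AllSuffixes P (x ∷ u) = P (x ∷ u) × AllSuffixes P u

  AllSuffixes-map : ∀ {p q} {P : Word → Set p} {Q : Word → Set q} → (∀ w → P w → Q w) → ∀ u → AllSuffixes P u → AllSuffixes Q u
  AllSuffixes-map f [] a = f [] a
  AllSuffixes-map f (x ∷ u) (a , as) = f (x ∷ u) a , AllSuffixes-map f u as

  AllSuffixes-head : ∀ {p} {P : Word → Set p} u → AllSuffixes P u → P u
  AllSuffixes-head [] a = a
  AllSuffixes-head (x ∷ u) (a , _) = a

  allSuffixes : ∀ {p} {P : Word → Set p} → (∀ w → P w) → ∀ u → AllSuffixes P u
  allSuffixes f [] = f []
  allSuffixes f (x ∷ u) = f (x ∷ u) , allSuffixes f u

  ext-Δw-suffixwise : ∀ {b} {B : Set b} {F G : Word × Word → Lin B} u →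
    AllSuffixes (λ q → ∀ p → F (p , q) ∼ G (p , q)) u → ext F (Δw u) ∼ ext G (Δw u)
  ext-Δw-suffixwise [] h = ++-congʳ [] (scale-congʳ 1# (h []))
  ext-Δw-suffixwise {F = F} {G} (x ∷ u) (h , hs) = ∼-trans (ext-Δw-∷ F x u)
    (∼-trans (h [] ⟨++⟩ ext-Δw-suffixwise u (AllSuffixes-map (λ q k p → k (x ∷ p)) u hs))
    (∼-sym (ext-Δw-∷ G x u)))

  weight : Ω → Word → Ω
  weight x [] = x
  weight x (y ∷ ys) = x ⊕ weight y ys

  ‖‖≡weight : ∀ x xs → ‖ x L⁺.∷ xs ‖ ≡ weight x xs
  ‖‖≡weight x [] = refl
  ‖‖≡weight x (y ∷ ys) = ≡.cong (x ⊕_) (‖‖≡weight y ys)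

  _⊕ᴹ_ : Maybe Ω → Maybe Ω → Maybe Ω
  nothing ⊕ᴹ y = y
  just x ⊕ᴹ nothing = just x
  just x ⊕ᴹ just y = just (x ⊕ y)

  ⊕ᴹ-identityʳ : ∀ x → x ⊕ᴹ nothing ≡ x
  ⊕ᴹ-identityʳ nothing = refl
  ⊕ᴹ-identityʳ (just x) = refl

  ⊕ᴹ-assoc : ∀ x y z → (x ⊕ᴹ y) ⊕ᴹ z ≡ x ⊕ᴹ (y ⊕ᴹ z)
  ⊕ᴹ-assoc nothing y z = refl
  ⊕ᴹ-assoc (just x) nothing z = refl
  ⊕ᴹ-assoc (just x) (just y) nothing = refl
  ⊕ᴹ-assoc (just x) (just y) (just z) = ≡.cong just (⊕-assoc x y z)

  ⊕ᴹ-comm : ∀ x y → x ⊕ᴹ y ≡ y ⊕ᴹ x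
  ⊕ᴹ-comm nothing y = ≡.sym (⊕ᴹ-identityʳ y)
  ⊕ᴹ-comm (just x) nothing = refl
  ⊕ᴹ-comm (just x) (just y) = ≡.cong just (⊕-comm x y)

  weightᴹ : Word → Maybe Ω
  weightᴹ [] = nothing
  weightᴹ (x ∷ t) = just (weight x t)

  weightᴹ-∷ : ∀ a t → weightᴹ (a ∷ t) ≡ just a ⊕ᴹ weightᴹ t
  weightᴹ-∷ a [] = refl
  weightᴹ-∷ a (y ∷ t) = refl

  weightᴹ-++ : ∀ x p r → weightᴹ (x ∷ p ++ r) ≡ weightᴹ (x ∷ p) ⊕ᴹ weightᴹ r
  weightᴹ-++ x [] r = weightᴹ-∷ x r
  weightᴹ-++ x (y ∷ p) r = ≡.trans (weightᴹ-∷ x (y ∷ p ++ r)) (≡.trans (≡.cong (just x ⊕ᴹ_) (weightᴹ-++ y p r))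
    (≡.trans (≡.sym (⊕ᴹ-assoc (just x) (weightᴹ (y ∷ p)) (weightᴹ r))) refl))

  weight-++ : ∀ x p r W → weightᴹ W ≡ weightᴹ r → weight x (p ++ r) ≡ weight (weight x p) W
  weight-++ x p r W e = just-injective (≡.trans (weightᴹ-++ x p r) (≡.trans (≡.cong (weightᴹ (x ∷ p) ⊕ᴹ_) (≡.sym e)) (≡.sym (weightᴹ-∷ (weight x p) W))))

  HasWeight : Maybe Ω → Word → Set o
  HasWeight m t = weightᴹ t ≡ m

  AllTerms-cons : ∀ a {m m′} → (just a ⊕ᴹ m ≡ m′) → ∀ {X} → AllTerms (HasWeight m) X → AllTerms (HasWeight m′) (cons a X)
  AllTerms-cons a {m} eq = AllTerms-relabel (a ∷_) (λ t w → ≡.trans (weightᴹ-∷ a t) (≡.trans (≡.cong (just a ⊕ᴹ_) w) eq))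

  sh-weight : ∀ u v → AllTerms (HasWeight (weightᴹ u ⊕ᴹ weightᴹ v)) (sh u v)
  sh-weight [] v = refl ∷ []
  sh-weight (a ∷ u) [] = ≡.sym (⊕ᴹ-identityʳ (weightᴹ (a ∷ u))) ∷ []
  sh-weight (a ∷ u) (b ∷ v) = AllTerms-++ (AllTerms-cons a e1 (sh-weight u (b ∷ v))) (AllTerms-++ (AllTerms-cons b e2 (sh-weight (a ∷ u) v)) (AllTerms-cons (a ⊕ b) e3 (sh-weight u v)))
    where
    ja jb : Maybe Ω
    ja = just a
    jb = just b
    e1 : ja ⊕ᴹ (weightᴹ u ⊕ᴹ weightᴹ (b ∷ v)) ≡ weightᴹ (a ∷ u) ⊕ᴹ weightᴹ (b ∷ v)
    e1 = ≡.trans (≡.sym (⊕ᴹ-assoc ja (weightᴹ u) (weightᴹ (b ∷ v)))) (≡.cong (_⊕ᴹ weightᴹ (b ∷ v)) (≡.sym (weightᴹ-∷ a u)))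
    e2 : jb ⊕ᴹ (weightᴹ (a ∷ u) ⊕ᴹ weightᴹ v) ≡ weightᴹ (a ∷ u) ⊕ᴹ weightᴹ (b ∷ v)
    e2 = ≡.trans (≡.sym (⊕ᴹ-assoc jb (weightᴹ (a ∷ u)) (weightᴹ v))) (≡.trans (≡.cong (_⊕ᴹ weightᴹ v) (⊕ᴹ-comm jb (weightᴹ (a ∷ u))))
          (≡.trans (⊕ᴹ-assoc (weightᴹ (a ∷ u)) jb (weightᴹ v)) (≡.cong (weightᴹ (a ∷ u) ⊕ᴹ_) (≡.sym (weightᴹ-∷ b v)))))
    e3 : just (a ⊕ b) ⊕ᴹ (weightᴹ u ⊕ᴹ weightᴹ v) ≡ weightᴹ (a ∷ u) ⊕ᴹ weightᴹ (b ∷ v)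
    e3 = ≡.trans (≡.cong (_⊕ᴹ (weightᴹ u ⊕ᴹ weightᴹ v)) (refl {x = ja ⊕ᴹ jb}))
         (≡.trans (⊕ᴹ-assoc ja jb (weightᴹ u ⊕ᴹ weightᴹ v)) (≡.trans (≡.cong (ja ⊕ᴹ_) (≡.trans (≡.sym (⊕ᴹ-assoc jb (weightᴹ u) (weightᴹ v)))
           (≡.trans (≡.cong (_⊕ᴹ weightᴹ v) (⊕ᴹ-comm jb (weightᴹ u))) (⊕ᴹ-assoc (weightᴹ u) jb (weightᴹ v)))))
         (≡.trans (≡.sym (⊕ᴹ-assoc ja (weightᴹ u) (jb ⊕ᴹ weightᴹ v))) (≡.cong₂ _⊕ᴹ_ (≡.sym (weightᴹ-∷ a u)) (≡.sym (weightᴹ-∷ b v))))))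

  -- The recursion for Γ

  addBlockᵇ : Ω → Word → Word × Word → H₂
  addBlockᵇ x p wp = ⟦ weight x p ∷ proj₁ wp ⟧ ⊗ sh (x ∷ p) (proj₂ wp)

  addBlock : Ω → Word → H₂ → H₂
  addBlock x p Y = ext (addBlockᵇ x p) Y

  addBlock-cong : ∀ a p {Y Y′} → Y ∼ Y′ → addBlock a p Y ∼ addBlock a p Y′
  addBlock-cong a p q = ext-cong (addBlockᵇ a p) q

  addBlockΓ : Ω → Word × Word → H₂
  addBlockΓ x s = addBlock x (proj₁ s) (Γw (proj₂ s))

  compositionTerm : List (List⁺ Ω) → H₂
  compositionTerm ps = ⟦ map ‖_‖ ps ⟧ ⊗ shuffleAll ps

  compositionTerm-∷ : ∀ x p cs → compositionTerm ((x L⁺.∷ p) ∷ cs) ∼ addBlock x p (compositionTerm cs)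
  compositionTerm-∷ x p cs =
    ∼-trans (∼-reflexive (≡.cong (λ k → ⟦ k ∷ M ⟧ ⊗ (⟦ x ∷ p ⟧ ⧢ S)) (‖‖≡weight x p)))
    (∼-trans (⊗-congʳ ⟦ weight x p ∷ M ⟧ (ext₂-basisˡ sh (x ∷ p) S))
    (∼-trans (⊗-basisˡ (weight x p ∷ M) (ext (sh (x ∷ p)) S))
    (∼-trans (∼-reflexive (relabel-ext _ (sh (x ∷ p)) S))
    (∼-trans (ext-pointwise S (λ P → ∼-sym (⊗-basisˡ (weight x p ∷ M) (sh (x ∷ p) P))))
    (∼-sym (∼-trans (ext-cong (addBlockᵇ x p) (⊗-basisˡ M S)) (∼-reflexive (ext-relabel (addBlockᵇ x p) (M ,_) S))))))))
    where
    M : Word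
    M = map ‖_‖ cs
    S : H
    S = shuffleAll cs

  addBlockʷ : Word → H₂ → H₂
  addBlockʷ [] Y = []
  addBlockʷ (y ∷ ys) Y = addBlock y ys Y

  addBlockʷ-cong : ∀ w {Y Y′} → Y ∼ Y′ → addBlockʷ w Y ∼ addBlockʷ w Y′
  addBlockʷ-cong [] p = ∼-refl
  addBlockʷ-cong (y ∷ ys) p = ext-cong (addBlockᵇ y ys) p

  addBlockʷ-concatMap : ∀ {a} {A : Set a} w (g : A → H₂) L → concatMap (λ c → addBlockʷ w (g c)) L ∼ addBlockʷ w (concatMap g L)
  addBlockʷ-concatMap [] g L = ∼-reflexive (concatMap-empty L)
  addBlockʷ-concatMap (y ∷ ys) g L = ∼-reflexive (≡.sym (concatMap-concatMap _ g L))

  prefixedTerm : Word → List (List⁺ Ω) → H₂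
  prefixedTerm pre [] = []
  prefixedTerm pre (b ∷ cs) = addBlockʷ (pre ++ toList b) (compositionTerm cs)

  compositionsStep : Ω → List (List⁺ Ω) → List (List (List⁺ Ω))
  compositionsStep x [] = (L⁺.[ x ] ∷ []) ∷ []
  compositionsStep x (p ∷ ps) = (L⁺.[ x ] ∷ p ∷ ps) ∷ ((x L⁺.∷⁺ p) ∷ ps) ∷ []

  compositions-∷ : ∀ x xs → compositions (x ∷ xs) ≡ concatMap (compositionsStep x) (compositions xs)
  compositions-∷ x xs = concatMap-cong (λ { [] → refl ; (p ∷ ps) → refl }) (compositions xs)

  compositionTerm-[] : compositionTerm [] ∼ Γw []
  compositionTerm-[] = ⊗-basis [] []

  -- Generalised over an accumulated prefix of the first block, so that the induction on xs goes through.
  prefixedTerms-∷ : ∀ pre x xs → concatMap (prefixedTerm pre) (compositions (x ∷ xs)) ∼ concatMap (λ s → addBlockʷ (pre ++ x ∷ proj₁ s) (Γw (proj₂ s))) (splits xs)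
  prefixedTerms-∷ pre x [] = ++-congʳ [] (addBlockʷ-cong (pre ++ x ∷ []) compositionTerm-[])
  prefixedTerms-∷ pre x (y ∷ ys) =
    ∼-trans (∼-reflexive (≡.trans (≡.cong (concatMap (prefixedTerm pre)) (compositions-∷ x (y ∷ ys))) (concatMap-concatMap (prefixedTerm pre) (compositionsStep x) L)))
    (∼-trans (concatMap-pointwise L pt)
    (∼-trans (concatMap-++ᶠ (λ c → addBlockʷ (pre ++ x ∷ []) (compositionTerm c)) (prefixedTerm (pre ++ x ∷ [])) L)
    (∼-++ (addBlockʷ-concatMap (pre ++ x ∷ []) compositionTerm L)
          (∼-trans (prefixedTerms-∷ (pre ++ x ∷ []) y ys)
            (∼-trans (concatMap-pointwise (splits ys) (λ s → ∼-reflexive (≡.cong (λ k → addBlockʷ k (Γw (proj₂ s))) (++-assoc pre (x ∷ []) (y ∷ proj₁ s)))))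
            (∼-reflexive (≡.sym (concatMap-map _ _ (splits ys)))))))))
    where
    L : List (List (List⁺ Ω))
    L = compositions (y ∷ ys)
    pt : ∀ c → concatMap (prefixedTerm pre) (compositionsStep x c) ∼ addBlockʷ (pre ++ x ∷ []) (compositionTerm c) ++ prefixedTerm (pre ++ x ∷ []) c
    pt [] = ∼-refl
    pt ((z L⁺.∷ zs) ∷ cs) = ++-congˡ (addBlockʷ (pre ++ x ∷ []) (compositionTerm ((z L⁺.∷ zs) ∷ cs)))
      (∼-trans (∼-reflexive (++-identityʳ _)) (∼-reflexive (≡.cong (λ k → addBlockʷ k (compositionTerm cs)) (≡.sym (++-assoc pre (x ∷ []) (z ∷ zs))))))

  Γw-∷-splits : ∀ x xs → Γw (x ∷ xs) ∼ concatMap (addBlockΓ x) (splits xs)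
  Γw-∷-splits x xs =
    ∼-trans (∼-reflexive (≡.trans (≡.cong (concatMap compositionTerm) (compositions-∷ x xs)) (concatMap-concatMap compositionTerm (compositionsStep x) L)))
    (∼-trans (concatMap-pointwise L pt)
    (∼-trans (∼-reflexive (≡.trans (≡.sym (concatMap-concatMap (prefixedTerm []) (compositionsStep x) L)) (≡.cong (concatMap (prefixedTerm [])) (≡.sym (compositions-∷ x xs)))))
    (prefixedTerms-∷ [] x xs)))
    where
    L : List (List (List⁺ Ω))
    L = compositions xs
    pt : ∀ c → concatMap compositionTerm (compositionsStep x c) ∼ concatMap (prefixedTerm []) (compositionsStep x c)
    pt [] = ++-congʳ [] (compositionTerm-∷ x [] [])
    pt ((z L⁺.∷ zs) ∷ cs) = compositionTerm-∷ x [] ((z L⁺.∷ zs) ∷ cs) ⟨++⟩ compositionTerm-∷ x (z ∷ zs) cs ⟨++⟩ ∼-refl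

  Γw-∷ : ∀ x xs → Γw (x ∷ xs) ∼ ext (addBlockΓ x) (Δw xs)
  Γw-∷ x xs = ∼-trans (Γw-∷-splits x xs) (∼-sym (ext-Δw _ xs))

  prefixΓ : Word × Word → H₂
  prefixΓ s = addBlockʷ (proj₁ s) (Γw (proj₂ s))

  ε𝟙₂ : Word → H₂
  ε𝟙₂ [] = 𝟙₂
  ε𝟙₂ (_ ∷ _) = []

  Γw-decomposition : ∀ w → Γw w ∼ ε𝟙₂ w ++ ext prefixΓ (Δw w)
  Γw-decomposition [] = ∼-refl
  Γw-decomposition (x ∷ xs) = ∼-trans (Γw-∷ x xs)
    (∼-sym (∼-trans (∼-reflexive (≡.trans (≡.cong (ext prefixΓ) (Δw-∷ x xs)) (ext-++ prefixΓ ⟦ ([] , x ∷ xs) ⟧ (consˡ x (Δw xs)))))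
      (∼-reflexive (ext-relabel prefixΓ (λ p → (x ∷ proj₁ p , proj₂ p)) (Δw xs)))))

  compositions-weight : ∀ w → All (λ ps → weightᴹ (map ‖_‖ ps) ≡ weightᴹ w) (compositions w)
  compositions-weight [] = refl ∷ []
  compositions-weight (x ∷ xs) = ≡.subst (All (λ ps → weightᴹ (map ‖_‖ ps) ≡ weightᴹ (x ∷ xs))) (≡.sym (compositions-∷ x xs))
    (concat⁺ (map⁺ (All.map step (compositions-weight xs))))
    where
    step : ∀ {c} → weightᴹ (map ‖_‖ c) ≡ weightᴹ xs → All (λ ps → weightᴹ (map ‖_‖ ps) ≡ weightᴹ (x ∷ xs)) (compositionsStep x c)
    step {[]} h = ≡.trans (≡.sym (⊕ᴹ-identityʳ (just x))) (≡.trans (≡.cong (just x ⊕ᴹ_) h) (≡.sym (weightᴹ-∷ x xs))) ∷ []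
    step {(y L⁺.∷ ys) ∷ cs} h =
      ≡.trans (weightᴹ-∷ x (map ‖_‖ ((y L⁺.∷ ys) ∷ cs))) (≡.trans (≡.cong (just x ⊕ᴹ_) h) (≡.sym (weightᴹ-∷ x xs)))
      ∷ (≡.trans (weightᴹ-∷ (x ⊕ ‖ y L⁺.∷ ys ‖) (map ‖_‖ cs))
          (≡.trans (⊕ᴹ-assoc (just x) (just ‖ y L⁺.∷ ys ‖) (weightᴹ (map ‖_‖ cs)))
          (≡.trans (≡.cong (just x ⊕ᴹ_) (≡.trans (≡.sym (weightᴹ-∷ ‖ y L⁺.∷ ys ‖ (map ‖_‖ cs))) h)) (≡.sym (weightᴹ-∷ x xs)))))
      ∷ []

  Γw-weight : ∀ w → AllTerms (λ wp → weightᴹ (proj₁ wp) ≡ weightᴹ w) (Γw w)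
  Γw-weight [] = refl ∷ []
  Γw-weight (x ∷ xs) = AllTerms-concatMap (λ ps → ⟦ map ‖_‖ ps ⟧ ⊗ shuffleAll ps) (compositions (x ∷ xs))
    (All.map (λ {ps} h → AllTerms-map (λ wp e → ≡.trans (≡.cong weightᴹ e) h) (AllTerms-⊗ˡ (map ‖_‖ ps) (shuffleAll ps))) (compositions-weight (x ∷ xs)))

  Δw-splits : ∀ w → AllTerms (λ s → proj₁ s ++ proj₂ s ≡ w) (Δw w)
  Δw-splits [] = refl ∷ []
  Δw-splits (x ∷ xs) = ≡.subst (AllTerms (λ s → proj₁ s ++ proj₂ s ≡ x ∷ xs)) (≡.sym (Δw-∷ x xs))
    (refl ∷ AllTerms-relabel _ (λ s e → ≡.cong (x ∷_) e) (Δw-splits xs))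

  -- Multiplicativity of Γ

  prependWith : Ω → (Word → H) → H₂ → H₂
  prependWith c f Y = ext (λ wp → ⟦ c ∷ proj₁ wp ⟧ ⊗ f (proj₂ wp)) Y

  prependWith-⊗ : ∀ c f U V → prependWith c f (U ⊗ V) ∼ cons c U ⊗ ext f V
  prependWith-⊗ c f U V = ∼-trans (ext-⊗ _ U V)
    (∼-sym (∼-trans (⊗-as-ext₂ (cons c U) (ext f V)) (∼-trans (ext₂-relabelˡ pairBasis (c ∷_) U (ext f V))
      (ext-pointwise U (λ w → ∼-trans (ext-ext (pairBasis (c ∷ w)) f V)
        (ext-pointwise V (λ t → ∼-trans (∼-sym (ext₂-basisˡ pairBasis (c ∷ w) (f t))) (∼-sym (⊗-as-ext₂ ⟦ c ∷ w ⟧ (f t))))))))))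

  addBlock-⊗ : ∀ a p U V → addBlock a p (U ⊗ V) ∼ cons (weight a p) U ⊗ (⟦ a ∷ p ⟧ ⧢ V)
  addBlock-⊗ a p U V = ∼-trans (prependWith-⊗ (weight a p) (sh (a ∷ p)) U V) (⊗-congʳ (cons (weight a p) U) (∼-sym (ext₂-basisˡ sh (a ∷ p) V)))

  prependWith⧢ : Ω → H → H₂ → H₂
  prependWith⧢ c S = prependWith c (λ t → S ⧢ ⟦ t ⟧)

  prependWith⧢-⊗ : ∀ c S U V → prependWith⧢ c S (U ⊗ V) ∼ cons c U ⊗ (S ⧢ V)
  prependWith⧢-⊗ c S U V = ∼-trans (prependWith-⊗ c _ U V) (⊗-congʳ (cons c U) (∼-trans (∼-sym (ext₂-extʳ sh ⟦_⟧ S V)) (⧢-congʳ S (ext-⟦⟧ V))))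

  prependWith-cong : ∀ c f {Y Y′} → Y ∼ Y′ → prependWith c f Y ∼ prependWith c f Y′
  prependWith-cong c f p = ext-cong _ p

  ε𝟙₂-sh : ∀ a u b v → ext ε𝟙₂ (sh (a ∷ u) (b ∷ v)) ∼ []
  ε𝟙₂-sh a u b v = ∼-trans (ext-pointwise-on {g = λ _ → []} (sh-weight (a ∷ u) (b ∷ v)) f) (ext-empty (sh (a ∷ u) (b ∷ v)))
    where
    f : ∀ t → HasWeight (weightᴹ (a ∷ u) ⊕ᴹ weightᴹ (b ∷ v)) t → ε𝟙₂ t ∼ []
    f [] ()
    f (x ∷ t) _ = ∼-refl

  prefixΓ-𝟙⊗ : ∀ X → ext prefixΓ (𝟙⊗ X) ∼ []
  prefixΓ-𝟙⊗ X = ∼-trans (∼-reflexive (ext-relabel prefixΓ _ X)) (ext-empty X)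

  addBlockʷ-ext : ∀ w (g : Word → H₂) Q → addBlockʷ w (ext g Q) ∼ ext (λ t → addBlockʷ w (g t)) Q
  addBlockʷ-ext [] g Q = ∼-sym (ext-empty Q)
  addBlockʷ-ext (y ∷ ys) g Q = ext-ext (addBlockᵇ y ys) g Q

  prefixΓ-⊗ : ∀ U Q → ext prefixΓ (U ⊗ Q) ∼ ext (λ w → addBlockʷ w (Γ Q)) U
  prefixΓ-⊗ U Q = ∼-trans (ext-⊗ prefixΓ U Q) (ext-pointwise U (λ w → ∼-sym (addBlockʷ-ext w Γw Q)))

  addBlockΓ-⊗ : ∀ x p Q → ext (λ s → addBlock x (proj₁ s) (Γw (proj₂ s))) (⟦ p ⟧ ⊗ Q) ∼ addBlock x p (Γ Q)
  addBlockΓ-⊗ x p Q = ∼-trans (ext-basis-⊗ (addBlockΓ x) p Q) (∼-sym (ext-ext (addBlockᵇ x p) Γw Q))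

  addBlockʷ-weight : ∀ c t Y → HasWeight (just c) t → addBlockʷ t Y ∼ prependWith⧢ c ⟦ t ⟧ Y
  addBlockʷ-weight c [] Y ()
  addBlockʷ-weight c (x ∷ r) Y refl = ext-pointwise Y (λ wp → ⊗-congʳ ⟦ weight x r ∷ proj₁ wp ⟧ (∼-sym (⧢-basis (x ∷ r) (proj₂ wp))))

  prependWith⧢-ext : ∀ c X Y → ext (λ t → prependWith⧢ c ⟦ t ⟧ Y) X ∼ prependWith⧢ c X Y
  prependWith⧢-ext c X Y = ∼-trans (ext-comm (λ t wp → ⟦ c ∷ proj₁ wp ⟧ ⊗ (⟦ t ⟧ ⧢ ⟦ proj₂ wp ⟧)) X Y)
    (ext-pointwise Y (λ wp → ∼-trans (∼-sym (⊗-extʳ ⟦ c ∷ proj₁ wp ⟧ (λ t → ⟦ t ⟧ ⧢ ⟦ proj₂ wp ⟧) X))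
      (⊗-congʳ ⟦ c ∷ proj₁ wp ⟧ (∼-trans (∼-sym (ext₂-extˡ sh ⟦_⟧ X ⟦ proj₂ wp ⟧)) (⧢-congˡ ⟦ proj₂ wp ⟧ (ext-⟦⟧ X))))))

  addBlockʷ-sh : ∀ a p b q Y → ext (λ w → addBlockʷ w Y) (sh (a ∷ p) (b ∷ q)) ∼ prependWith⧢ (weight a p ⊕ weight b q) (sh (a ∷ p) (b ∷ q)) Y
  addBlockʷ-sh a p b q Y = ∼-trans (ext-pointwise-on (sh-weight (a ∷ p) (b ∷ q)) (λ t w → addBlockʷ-weight (weight a p ⊕ weight b q) t Y w))
    (prependWith⧢-ext _ (sh (a ∷ p) (b ∷ q)) Y)

  -- In a product of two terms with leading blocks a p and b q, either block comes
  -- first or the two blocks are merged: the quasi-shuffle recursion one level up.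
  module _ (a : Ω) (p : Word) (b : Ω) (q : Word) where

    private
      wa wb : Ω
      wa = weight a p
      wb = weight b q

    aBlockFirstᵇ bBlockFirstᵇ mergedBlocksᵇ : Word × Word → Word × Word → H₂
    aBlockFirstᵇ y z = addBlock a p (ext (sh₂ y) (addBlockᵇ b q z))
    bBlockFirstᵇ y z = addBlock b q (ext (λ w → sh₂ w z) (addBlockᵇ a p y))
    mergedBlocksᵇ y z = prependWith⧢ (wa ⊕ wb) (sh (a ∷ p) (b ∷ q)) (sh₂ y z)

    addBlockᵇ-⧢₂ : ∀ y z → addBlockᵇ a p y ⧢₂ addBlockᵇ b q z ∼ aBlockFirstᵇ y z ++ (bBlockFirstᵇ y z ++ mergedBlocksᵇ y z)
    addBlockᵇ-⧢₂ (W , P) (W′ , P′) =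
      ∼-trans (⧢₂-⊗ ⟦ wa ∷ W ⟧ XP ⟦ wb ∷ W′ ⟧ YP′)
      (∼-trans (⊗-cong (⧢-basis (wa ∷ W) (wb ∷ W′)) (⧢-cong (∼-sym (⧢-basis (a ∷ p) P)) (∼-sym (⧢-basis (b ∷ q) P′))))
      (∼-trans (∼-reflexive (≡.trans (⊗-++ˡ (cons wa (sh W (wb ∷ W′))) _ Total)
                                     (≡.cong (cons wa (sh W (wb ∷ W′)) ⊗ Total ++_) (⊗-++ˡ (cons wb (sh (wa ∷ W) W′)) _ Total))))
      (∼-sym (aFirst ⟨++⟩ bFirst ⟨++⟩ merged))))
      where
      open CommutativeMonoidSolver ⧢-commutativeMonoid using (solve; _⊜_) renaming (_⊕_ to _⊞_)
      X Y U V XP YP′ Total : H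
      X = ⟦ a ∷ p ⟧
      Y = ⟦ b ∷ q ⟧
      U = ⟦ P ⟧
      V = ⟦ P′ ⟧
      XP = sh (a ∷ p) P
      YP′ = sh (b ∷ q) P′
      Total = (X ⧢ U) ⧢ (Y ⧢ V)
      aFirst : aBlockFirstᵇ (W , P) (W′ , P′) ∼ cons wa (sh W (wb ∷ W′)) ⊗ Total
      aFirst = ∼-trans (addBlock-cong a p (∼-trans (∼-sym (ext₂-basisˡ sh₂ (W , P) (⟦ wb ∷ W′ ⟧ ⊗ YP′)))
                 (∼-trans (⧢₂-congˡ (⟦ wb ∷ W′ ⟧ ⊗ YP′) (⟦⟧-⊗ (W , P)))
                 (∼-trans (⧢₂-⊗ ⟦ W ⟧ U ⟦ wb ∷ W′ ⟧ YP′) (⊗-congˡ (U ⧢ YP′) (⧢-basis W (wb ∷ W′)))))))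
        (∼-trans (addBlock-⊗ a p (sh W (wb ∷ W′)) (U ⧢ YP′))
        (⊗-congʳ (cons wa (sh W (wb ∷ W′)))
          (∼-trans (⧢-congʳ X (⧢-congʳ U (∼-sym (⧢-basis (b ∷ q) P′))))
                   (solve 4 (λ x y u v → x ⊞ (u ⊞ (y ⊞ v)) ⊜ (x ⊞ u) ⊞ (y ⊞ v)) ∼-refl X Y U V))))
      bFirst : bBlockFirstᵇ (W , P) (W′ , P′) ∼ cons wb (sh (wa ∷ W) W′) ⊗ Total
      bFirst = ∼-trans (addBlock-cong b q (∼-trans (∼-sym (ext₂-basisʳ sh₂ (⟦ wa ∷ W ⟧ ⊗ XP) (W′ , P′)))
                 (∼-trans (⧢₂-congʳ (⟦ wa ∷ W ⟧ ⊗ XP) (⟦⟧-⊗ (W′ , P′)))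
                 (∼-trans (⧢₂-⊗ ⟦ wa ∷ W ⟧ XP ⟦ W′ ⟧ V) (⊗-congˡ (XP ⧢ V) (⧢-basis (wa ∷ W) W′))))))
        (∼-trans (addBlock-⊗ b q (sh (wa ∷ W) W′) (XP ⧢ V))
        (⊗-congʳ (cons wb (sh (wa ∷ W) W′))
          (∼-trans (⧢-congʳ Y (⧢-congˡ V (∼-sym (⧢-basis (a ∷ p) P))))
                   (solve 4 (λ x y u v → y ⊞ ((x ⊞ u) ⊞ v) ⊜ (x ⊞ u) ⊞ (y ⊞ v)) ∼-refl X Y U V))))
      merged : mergedBlocksᵇ (W , P) (W′ , P′) ∼ cons (wa ⊕ wb) (sh W W′) ⊗ Total
      merged = ∼-trans (prependWith⧢-⊗ (wa ⊕ wb) (sh (a ∷ p) (b ∷ q)) (sh W W′) (sh P P′))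
        (⊗-congʳ (cons (wa ⊕ wb) (sh W W′))
          (∼-trans (⧢-cong (∼-sym (⧢-basis (a ∷ p) (b ∷ q))) (∼-sym (⧢-basis P P′)))
                   (solve 4 (λ x y u v → (x ⊞ y) ⊞ (u ⊞ v) ⊜ (x ⊞ u) ⊞ (y ⊞ v)) ∼-refl X Y U V)))

    addBlock-⧢₂ : ∀ Y Z → addBlock a p Y ⧢₂ addBlock b q Z ∼
      addBlock a p (Y ⧢₂ addBlock b q Z) ++ (addBlock b q (addBlock a p Y ⧢₂ Z) ++ prependWith⧢ (wa ⊕ wb) (sh (a ∷ p) (b ∷ q)) (Y ⧢₂ Z))
    addBlock-⧢₂ Y Z = ∼-trans (ext₂-ext sh₂ (addBlockᵇ a p) (addBlockᵇ b q) Y Z)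
      (∼-trans (ext₂-pointwise Y Z addBlockᵇ-⧢₂)
      (∼-trans (ext₂-++ᶠ aBlockFirstᵇ (λ y z → bBlockFirstᵇ y z ++ mergedBlocksᵇ y z) Y Z)
      (∼-trans (++-congˡ (ext₂ aBlockFirstᵇ Y Z) (ext₂-++ᶠ bBlockFirstᵇ mergedBlocksᵇ Y Z))
      (∼-sym (∼-trans (addBlock-cong a p (ext₂-extʳ′ sh₂ (addBlockᵇ b q) Y Z)) (ext-ext₂ (addBlockᵇ a p) _ Y Z)
        ⟨++⟩ ∼-trans (addBlock-cong b q (ext₂-extˡ′ sh₂ (addBlockᵇ a p) Y Z)) (ext-ext₂ (addBlockᵇ b q) _ Y Z)
        ⟨++⟩ ext-ext₂ _ sh₂ Y Z)))))

  Γ-Multiplicative : Word → Word → Set _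
  Γ-Multiplicative u v = Γ (sh u v) ∼ Γw u ⧢₂ Γw v

  module _ (a : Ω) (u : Word) (b : Ω) (v : Word) where

    aBlockFirst bBlockFirst mergedBlocks : H₂
    aBlockFirst = ext (λ s → addBlock a (proj₁ s) (Γw (proj₂ s) ⧢₂ Γw (b ∷ v))) (Δw u)
    bBlockFirst = ext (λ s → addBlock b (proj₁ s) (Γw (a ∷ u) ⧢₂ Γw (proj₂ s))) (Δw v)
    mergedBlocks = ext₂ (λ s s′ → prependWith⧢ (weight a (proj₁ s) ⊕ weight b (proj₁ s′)) (sh (a ∷ proj₁ s) (b ∷ proj₁ s′))
                                               (Γw (proj₂ s) ⧢₂ Γw (proj₂ s′)))
                        (Δw u) (Δw v)

    Γw-⧢₂-Γw : Γw (a ∷ u) ⧢₂ Γw (b ∷ v) ∼ aBlockFirst ++ (bBlockFirst ++ mergedBlocks)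
    Γw-⧢₂-Γw = ∼-trans (⧢₂-cong (Γw-∷ a u) (Γw-∷ b v))
      (∼-trans (ext₂-ext sh₂ (addBlockΓ a) (addBlockΓ b) (Δw u) (Δw v))
      (∼-trans (ext₂-pointwise (Δw u) (Δw v) (λ s s′ → addBlock-⧢₂ a (proj₁ s) b (proj₁ s′) (Γw (proj₂ s)) (Γw (proj₂ s′))))
      (∼-trans (ext₂-++ᶠ aFirst _ (Δw u) (Δw v))
      (∼-trans (++-congˡ (ext₂ aFirst (Δw u) (Δw v)) (ext₂-++ᶠ bFirst _ (Δw u) (Δw v)))
      (ext-pointwise (Δw u) (λ s → ∼-trans (∼-sym (ext-ext (addBlockᵇ a (proj₁ s)) _ (Δw v)))
          (addBlock-cong a (proj₁ s) (∼-trans (∼-sym (ext₂-extʳ sh₂ (addBlockΓ b) (Γw (proj₂ s)) (Δw v)))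
                                               (⧢₂-congʳ (Γw (proj₂ s)) (∼-sym (Γw-∷ b v))))))
       ⟨++⟩ ∼-trans (ext-comm bFirst (Δw u) (Δw v)) (ext-pointwise (Δw v) (λ s′ → ∼-trans (∼-sym (ext-ext (addBlockᵇ b (proj₁ s′)) _ (Δw u)))
          (addBlock-cong b (proj₁ s′) (∼-trans (∼-sym (ext₂-extˡ sh₂ (addBlockΓ a) (Δw u) (Γw (proj₂ s′))))
                                                (⧢₂-congˡ (Γw (proj₂ s′)) (∼-sym (Γw-∷ a u)))))))
       ⟨++⟩ ∼-refl)))))
      where
      aFirst bFirst : Word × Word → Word × Word → H₂
      aFirst s s′ = addBlock a (proj₁ s) (Γw (proj₂ s) ⧢₂ addBlock b (proj₁ s′) (Γw (proj₂ s′)))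
      bFirst s s′ = addBlock b (proj₁ s′) (addBlock a (proj₁ s) (Γw (proj₂ s)) ⧢₂ Γw (proj₂ s′))

    prefixΓ-bBlockFirst : AllSuffixes (Γ-Multiplicative (a ∷ u)) v →
                          ext prefixΓ (⟦ ([] , a ∷ u) ⟧ ⧢₂ consˡ b (Δw v)) ∼ bBlockFirst
    prefixΓ-bBlockFirst ih = ∼-trans (ext-cong prefixΓ (𝟙⊗-⧢₂-consˡ b (a ∷ u) (Δw v)))
      (∼-trans (∼-reflexive (ext-relabel prefixΓ _ (⟦ ([] , a ∷ u) ⟧ ⧢₂ Δw v)))
      (∼-trans (ext-cong (addBlockΓ b) (ext₂-basisˡ sh₂ ([] , a ∷ u) (Δw v)))
      (∼-trans (ext-ext (addBlockΓ b) (sh₂ ([] , a ∷ u)) (Δw v))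
      (ext-Δw-suffixwise v (AllSuffixes-map (λ q′ m p′ → ∼-trans (addBlockΓ-⊗ b p′ (sh (a ∷ u) q′)) (addBlock-cong b p′ m)) v ih)))))

    prefixΓ-aBlockFirst : AllSuffixes (λ q → Γ-Multiplicative q (b ∷ v)) u →
                          ext prefixΓ (consˡ a (Δw u) ⧢₂ ⟦ ([] , b ∷ v) ⟧) ∼ aBlockFirst
    prefixΓ-aBlockFirst ih = ∼-trans (ext-cong prefixΓ (consˡ-⧢₂-𝟙⊗ a (Δw u) (b ∷ v)))
      (∼-trans (∼-reflexive (ext-relabel prefixΓ _ (Δw u ⧢₂ ⟦ ([] , b ∷ v) ⟧)))
      (∼-trans (ext-cong (addBlockΓ a) (ext₂-basisʳ sh₂ (Δw u) ([] , b ∷ v)))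
      (∼-trans (ext-ext (addBlockΓ a) (λ s → sh₂ s ([] , b ∷ v)) (Δw u))
      (ext-Δw-suffixwise u (AllSuffixes-map (λ q m p →
        ∼-trans (∼-reflexive (≡.cong (λ k → ext (addBlockΓ a) (k ⊗ sh q (b ∷ v))) (sh-identityʳ p)))
                (∼-trans (addBlockΓ-⊗ a p (sh q (b ∷ v))) (addBlock-cong a p m))) u ih)))))

    prefixΓ-mergedBlocks : AllSuffixes (λ q → AllSuffixes (Γ-Multiplicative q) v) u →
                           ext prefixΓ (consˡ a (Δw u) ⧢₂ consˡ b (Δw v)) ∼ mergedBlocks
    prefixΓ-mergedBlocks ih = ∼-trans (ext-cong prefixΓ (ext₂-relabel sh₂ _ _ (Δw u) (Δw v)))
      (∼-trans (ext-ext₂ prefixΓ _ (Δw u) (Δw v))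
      (ext-Δw-suffixwise u (AllSuffixes-map (λ q ihq p → ext-Δw-suffixwise v (AllSuffixes-map (λ q′ m p′ →
        ∼-trans (prefixΓ-⊗ (sh (a ∷ p) (b ∷ p′)) (sh q q′))
                (∼-trans (addBlockʷ-sh a p b p′ (Γ (sh q q′))) (prependWith-cong _ _ m))) v ihq)) u ih)))

    Γ-sh-∷ : AllSuffixes (Γ-Multiplicative (a ∷ u)) v → AllSuffixes (λ q → Γ-Multiplicative q (b ∷ v)) u →
             AllSuffixes (λ q → AllSuffixes (Γ-Multiplicative q) v) u →
             Γ (sh (a ∷ u) (b ∷ v)) ∼ bBlockFirst ++ (aBlockFirst ++ mergedBlocks)
    Γ-sh-∷ ih₁ ih₂ ih₃ = ∼-trans (ext-pointwise (sh (a ∷ u) (b ∷ v)) Γw-decomposition)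
      (∼-trans (ext-++ᶠ ε𝟙₂ (λ w → ext prefixΓ (Δw w)) (sh (a ∷ u) (b ∷ v)))
      (∼-trans (∼-++ (ε𝟙₂-sh a u b v) (∼-sym (ext-ext prefixΓ Δw (sh (a ∷ u) (b ∷ v)))))
      (∼-trans (ext-cong prefixΓ (∼-trans (Δw-sh (a ∷ u) (b ∷ v)) (∼-reflexive (≡.cong₂ _⧢₂_ (Δw-∷ a u) (Δw-∷ b v)))))
      (∼-trans (∼-reflexive (≡.cong (ext prefixΓ) (ext₂-++ˡ sh₂ Eu (consˡ a (Δw u)) (Ev ++ consˡ b (Δw v)))))
      (∼-trans (ext-cong prefixΓ (ext₂-++ʳ sh₂ Eu Ev (consˡ b (Δw v)) ⟨++⟩ ext₂-++ʳ sh₂ (consˡ a (Δw u)) Ev (consˡ b (Δw v))))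
      (∼-trans (∼-reflexive (≡.trans (ext-++ prefixΓ (Eu ⧢₂ Ev ++ Eu ⧢₂ consˡ b (Δw v)) _)
                                     (≡.cong₂ _++_ (ext-++ prefixΓ (Eu ⧢₂ Ev) _) (ext-++ prefixΓ (consˡ a (Δw u) ⧢₂ Ev) _))))
      (∼-++ (∼-++ (∼-trans (ext-cong prefixΓ (𝟙⊗-⧢₂-𝟙⊗ (a ∷ u) (b ∷ v))) (prefixΓ-𝟙⊗ (sh (a ∷ u) (b ∷ v))))
                  (prefixΓ-bBlockFirst ih₁))
            (prefixΓ-aBlockFirst ih₂ ⟨++⟩ prefixΓ-mergedBlocks ih₃))))))))
      where
      Eu Ev : H₂
      Eu = ⟦ ([] , a ∷ u) ⟧
      Ev = ⟦ ([] , b ∷ v) ⟧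

  Γw-sh-[]ˡ : ∀ v → Γ-Multiplicative [] v
  Γw-sh-[]ˡ v = ∼-trans (ext-basis Γw v) (∼-sym (⧢₂-identityˡ (Γw v)))

  Γw-sh-[]ʳ : ∀ u → Γ-Multiplicative u []
  Γw-sh-[]ʳ u = ∼-trans (ext-cong Γw (∼-reflexive (sh-identityʳ u))) (∼-trans (ext-basis Γw u) (∼-sym (⧢₂-identityʳ (Γw u))))

  Γw-sh-∷ : ∀ a u b v →
    AllSuffixes (Γ-Multiplicative (a ∷ u)) v → AllSuffixes (λ q → Γ-Multiplicative q (b ∷ v)) u →
    AllSuffixes (λ q → AllSuffixes (Γ-Multiplicative q) v) u → Γ-Multiplicative (a ∷ u) (b ∷ v)
  Γw-sh-∷ a u b v ih₁ ih₂ ih₃ = ∼-trans (Γ-sh-∷ a u b v ih₁ ih₂ ih₃)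
    (∼-trans (++-swapˡ (bBlockFirst a u b v) (aBlockFirst a u b v) (mergedBlocks a u b v)) (∼-sym (Γw-⧢₂-Γw a u b v)))

  Γw-sh-suffixes : ∀ u v → AllSuffixes (λ q → AllSuffixes (Γ-Multiplicative q) v) u
  Γw-sh-suffixes [] v = allSuffixes Γw-sh-[]ˡ v
  Γw-sh-suffixes (a ∷ u) [] = Γw-sh-[]ʳ (a ∷ u) , Γw-sh-suffixes u []
  Γw-sh-suffixes (a ∷ u) (b ∷ v) =
    (Γw-sh-∷ a u b v (proj₁ (Γw-sh-suffixes (a ∷ u) v))
                     (AllSuffixes-map (λ q → AllSuffixes-head (b ∷ v)) u (Γw-sh-suffixes u (b ∷ v)))
                     (Γw-sh-suffixes u v)
     , proj₁ (Γw-sh-suffixes (a ∷ u) v))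
    , Γw-sh-suffixes u (b ∷ v)

  Γw-sh : ∀ u v → Γ-Multiplicative u v
  Γw-sh u v = AllSuffixes-head v (AllSuffixes-head u (Γw-sh-suffixes u v))

  Γ-⧢ : ∀ u v → Γ (u ⧢ v) ∼ Γ u ⧢₂ Γ v
  Γ-⧢ u v = ∼-trans (ext-ext₂ Γw sh u v) (∼-trans (ext₂-pointwise u v Γw-sh) (∼-sym (ext₂-ext sh₂ Γw Γw u v)))

  Γ-𝟙 : Γ 𝟙 ∼ 𝟙₂
  Γ-𝟙 = ext-basis Γw []

  -- The comodule identity

  Δ⊗id : Word × Word → Lin ((Word × Word) × Word)
  Δ⊗id = Δw ⊗ᶠ idᶠ

  Γ⊗Γ : Word × Word → Lin ((Word × Word) × (Word × Word))
  Γ⊗Γ = Γw ⊗ᶠ Γw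

  insert𝟙 : Word × Word → (Word × Word) × Word
  insert𝟙 wp = (([] , proj₁ wp) , proj₂ wp)

  addBlock₃ᵇ : Ω → Word → (Word × Word) × Word → Lin ((Word × Word) × Word)
  addBlock₃ᵇ x p r = ⟦ (weight x p ∷ proj₁ (proj₁ r) , proj₂ (proj₁ r)) ⟧ ⊗ sh (x ∷ p) (proj₂ r)

  addBlock₃ : Ω → Word → Lin ((Word × Word) × Word) → Lin ((Word × Word) × Word)
  addBlock₃ x p Z = ext (addBlock₃ᵇ x p) Z

  Δ⊗id-addBlockᵇ : ∀ x p y → ext Δ⊗id (addBlockᵇ x p y) ∼ relabel insert𝟙 (addBlockᵇ x p y) ++ addBlock₃ x p (Δ⊗id y)
  Δ⊗id-addBlockᵇ x p (W , P′) =
    ∼-trans (ext-basis-⊗ Δ⊗id cW S)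
    (∼-trans (∼-sym (⊗-extʳ (Δw cW) ⟦_⟧ S))
    (∼-trans (⊗-congʳ (Δw cW) (ext-⟦⟧ S))
    (∼-trans (∼-reflexive (≡.trans (≡.cong (_⊗ S) (Δw-∷ c′ W)) (⊗-++ˡ ⟦ ([] , cW) ⟧ (consˡ c′ (Δw W)) S)))
    (∼-++ (∼-reflexive (≡.sym (relabel-⊗ˡ (λ w → ([] , w)) ⟦ cW ⟧ S)))
          (∼-trans (relabel-⊗ (λ w → (c′ ∷ proj₁ w , proj₂ w)) (Δw W) S)
            (∼-sym (∼-trans (ext-⊗ _ (Δw W) ⟦ P′ ⟧) (ext₂-basisʳ (λ w t → ⟦ (c′ ∷ proj₁ w , proj₂ w) ⟧ ⊗ sh (x ∷ p) t) (Δw W) P′))))))))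
    where
    c′ : Ω
    c′ = weight x p
    cW : Word
    cW = c′ ∷ W
    S : H
    S = sh (x ∷ p) P′

  Δ⊗id-addBlock : ∀ x p Y → ext Δ⊗id (addBlock x p Y) ∼ relabel insert𝟙 (addBlock x p Y) ++ addBlock₃ x p (ext Δ⊗id Y)
  Δ⊗id-addBlock x p Y = ∼-trans (ext-ext Δ⊗id (addBlockᵇ x p) Y)
    (∼-trans (ext-pointwise Y (Δ⊗id-addBlockᵇ x p))
    (∼-trans (ext-++ᶠ (λ y → relabel insert𝟙 (addBlockᵇ x p y)) (λ y → addBlock₃ x p (Δ⊗id y)) Y)
    (∼-++ (∼-reflexive (≡.sym (relabel-ext insert𝟙 (addBlockᵇ x p) Y))) (∼-sym (ext-ext _ Δ⊗id Y)))))

  m₂₄τ-addBlockᵇ : ∀ x p y z → ext (λ w → m₂₄τ (w , z)) (addBlockᵇ x p y) ∼ addBlock₃ x p (m₂₄τ (y , z))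
  m₂₄τ-addBlockᵇ x p (W₁ , P₁) (W₂ , P₂) =
    ∼-trans (ext-basis-⊗ _ (c′ ∷ W₁) (sh (x ∷ p) P₁)) (∼-trans (∼-reflexive (≡.sym (relabel-ext g′ (λ t → sh t P₂) (sh (x ∷ p) P₁))))
    (∼-trans (relabel-cong g′ (sh-assoc (x ∷ p) P₁ P₂))
    (∼-trans (∼-reflexive (relabel-ext g′ (sh (x ∷ p)) (sh P₁ P₂)))
    (∼-sym (∼-trans (∼-reflexive (ext-relabel _ _ (sh P₁ P₂)))
      (ext-pointwise (sh P₁ P₂) (λ t → ⊗-basisˡ (c′ ∷ W₁ , W₂) (sh (x ∷ p) t))))))))
    where
    c′ : Ω
    c′ = weight x p
    g′ : Word → (Word × Word) × Word
    g′ w = ((c′ ∷ W₁ , W₂) , w)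

  m₂₄τ-addBlock : ∀ x p Y Z → ext m₂₄τ (addBlock x p Y ⊗ Z) ∼ addBlock₃ x p (ext m₂₄τ (Y ⊗ Z))
  m₂₄τ-addBlock x p Y Z = ∼-trans (ext-⊗ m₂₄τ (addBlock x p Y) Z)
    (∼-trans (ext₂-extˡ′ (λ u z → m₂₄τ (u , z)) (addBlockᵇ x p) Y Z)
    (∼-trans (ext₂-pointwise Y Z (m₂₄τ-addBlockᵇ x p))
    (∼-sym (∼-trans (ext-cong (λ r → ⟦ (weight x p ∷ proj₁ (proj₁ r) , proj₂ (proj₁ r)) ⟧ ⊗ sh (x ∷ p) (proj₂ r)) (ext-⊗ m₂₄τ Y Z))
      (ext-ext₂ _ (λ y z → m₂₄τ (y , z)) Y Z)))))

  m₂₄τ-𝟙₂⊗ : ∀ V → ext m₂₄τ (𝟙₂ ⊗ V) ∼ relabel insert𝟙 V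
  m₂₄τ-𝟙₂⊗ V = ∼-trans (ext-basis-⊗ m₂₄τ ([] , []) V) (∼-sym (relabel-as-ext insert𝟙 V))

  Comodule : Word → Set _
  Comodule w = ext Δ⊗id (Γw w) ∼ ext m₂₄τ (ext Γ⊗Γ (Δw w))

  comoduleTail : Ω → Word → Lin ((Word × Word) × Word)
  comoduleTail x xs = ext (λ s → addBlock₃ x (proj₁ s) (ext m₂₄τ (ext Γ⊗Γ (Δw (proj₂ s))))) (Δw xs)

  Δ⊗id-Γw-∷ : ∀ x xs → AllSuffixes Comodule xs → ext Δ⊗id (Γw (x ∷ xs)) ∼ relabel insert𝟙 (Γw (x ∷ xs)) ++ comoduleTail x xs
  Δ⊗id-Γw-∷ x xs ih = ∼-trans (ext-cong Δ⊗id (Γw-∷ x xs))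
    (∼-trans (ext-ext Δ⊗id (addBlockΓ x) (Δw xs))
    (∼-trans (ext-pointwise (Δw xs) (λ s → Δ⊗id-addBlock x (proj₁ s) (Γw (proj₂ s))))
    (∼-trans (ext-++ᶠ _ _ (Δw xs))
    (∼-trans (∼-reflexive (≡.sym (relabel-ext insert𝟙 (addBlockΓ x) (Δw xs)))) (relabel-cong insert𝟙 (∼-sym (Γw-∷ x xs)))
     ⟨++⟩ ext-Δw-suffixwise xs (AllSuffixes-map (λ q h p → ext-cong (addBlock₃ᵇ x p) h) xs ih)))))

  m₂₄τ-Γ⊗Γ-Δw-∷ : ∀ x xs → ext m₂₄τ (ext Γ⊗Γ (Δw (x ∷ xs))) ∼ relabel insert𝟙 (Γw (x ∷ xs)) ++ comoduleTail x xs
  m₂₄τ-Γ⊗Γ-Δw-∷ x xs = ∼-trans (ext-ext m₂₄τ Γ⊗Γ (Δw (x ∷ xs)))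
    (∼-trans (ext-Δw-∷ _ x xs)
    (∼-++ (m₂₄τ-𝟙₂⊗ (Γw (x ∷ xs)))
      (∼-trans (ext-pointwise (Δw xs) (λ s →
                 ∼-trans (ext-cong m₂₄τ (⊗-congˡ (Γw (proj₂ s)) (Γw-∷ x (proj₁ s))))
                 (∼-trans (ext-cong m₂₄τ (⊗-extˡ (addBlockΓ x) (Δw (proj₁ s)) (Γw (proj₂ s))))
                 (∼-trans (ext-ext m₂₄τ _ (Δw (proj₁ s)))
                 (ext-pointwise (Δw (proj₁ s)) (λ t → m₂₄τ-addBlock x (proj₁ t) (Γw (proj₂ t)) (Γw (proj₂ s))))))))
      (∼-trans (Δw-coassoc (λ p r q → addBlock₃ x p (ext m₂₄τ (Γw r ⊗ Γw q))) xs)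
      (ext-pointwise (Δw xs) (λ s → ∼-trans (∼-sym (ext-ext _ (λ t → ext m₂₄τ (Γw (proj₁ t) ⊗ Γw (proj₂ t))) (Δw (proj₂ s))))
          (ext-cong (addBlock₃ᵇ x (proj₁ s)) (∼-sym (ext-ext m₂₄τ Γ⊗Γ (Δw (proj₂ s)))))))))))

  comodule-[] : Comodule []
  comodule-[] = ∼-trans (ext-basis Δ⊗id ([] , []))
    (∼-trans (⊗-basis ([] , []) [])
    (∼-sym (∼-trans (ext-cong m₂₄τ (ext-basis Γ⊗Γ ([] , [])))
           (∼-trans (ext-cong m₂₄τ (⊗-basis ([] , []) ([] , []))) (ext-basis m₂₄τ (([] , []) , ([] , [])))))))

  comodule-suffixes : ∀ w → AllSuffixes Comodule w
  comodule-suffixes [] = comodule-[]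
  comodule-suffixes (x ∷ xs) =
    ∼-trans (Δ⊗id-Γw-∷ x xs (comodule-suffixes xs)) (∼-sym (m₂₄τ-Γ⊗Γ-Δw-∷ x xs)) , comodule-suffixes xs

  Γw-comodule : ∀ w → Comodule w
  Γw-comodule w = AllSuffixes-head w (comodule-suffixes w)

  Γ-comodule : ∀ u → ext (Δw ⊗ᶠ idᶠ) (Γ u) ∼ ext m₂₄τ (ext (Γw ⊗ᶠ Γw) (Δ u))
  Γ-comodule u = ∼-trans (ext-ext Δ⊗id Γw u)
    (∼-trans (ext-pointwise u Γw-comodule)
    (∼-sym (∼-trans (ext-cong m₂₄τ (ext-ext Γ⊗Γ Δw u)) (ext-ext m₂₄τ _ u))))

  -- Counits

  -- The counit of Γ: (η ⊗ id) ∘ Γ keeps the composition with a single block, and (id ⊗ η) ∘ Γ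
  -- keeps, from the composition into letters, the term of their quasi-shuffle merging all of them.
  η : Word → Carrier
  η [] = 1#
  η (_ ∷ []) = 1#
  η (_ ∷ _ ∷ _) = 0#

  η-cons : ∀ a t → η (a ∷ t) ≡ ε t
  η-cons a [] = refl
  η-cons a (_ ∷ _) = refl

  evalL-ε-cons : ∀ a X → evalL ε (cons a X) ≈ 0#
  evalL-ε-cons a X = ≈-trans (≈-reflexive (evalL-relabel ε (a ∷_) X)) (evalL-zero X)

  evalL-η-cons : ∀ a X → evalL η (cons a X) ≈ evalL ε X
  evalL-η-cons a X = ≈-trans (≈-reflexive (evalL-relabel η (a ∷_) X)) (evalL-pointwise X (λ t → ≈-reflexive (η-cons a t)))

  evalL-++₃ : ∀ {f : Word → Carrier} (X Y Z : H) → evalL f (X ++ (Y ++ Z)) ≈ evalL f X + (evalL f Y + evalL f Z)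
  evalL-++₃ {f} X Y Z = ≈-trans (evalL-++ f X (Y ++ Z)) (+-congˡ (evalL-++ f Y Z))

  ε-sh : ∀ u v → evalL ε (sh u v) ≈ ε u * ε v
  ε-sh [] v = ≈-trans (evalL-basis ε v) (≈-sym (*-identityˡ (ε v)))
  ε-sh (a ∷ u) [] = ≈-trans (evalL-basis ε (a ∷ u)) (≈-sym (zeroˡ 1#))
  ε-sh (a ∷ u) (b ∷ v) = ≈-trans (evalL-++₃ {ε} (cons a (sh u (b ∷ v))) (cons b (sh (a ∷ u) v)) (cons (a ⊕ b) (sh u v)))
    (≈-trans (+-cong (evalL-ε-cons a (sh u (b ∷ v))) (+-cong (evalL-ε-cons b (sh (a ∷ u) v)) (evalL-ε-cons (a ⊕ b) (sh u v))))
    (≈-trans (+-identityˡ _) (≈-trans (+-identityˡ 0#) (≈-sym (zeroˡ 0#)))))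

  η-sh : ∀ u v → evalL η (sh u v) ≈ η u * η v
  η-sh [] v = ≈-trans (evalL-basis η v) (≈-sym (*-identityˡ (η v)))
  η-sh (a ∷ u) [] = ≈-trans (evalL-basis η (a ∷ u)) (≈-sym (*-identityʳ (η (a ∷ u))))
  η-sh (a ∷ u) (b ∷ v) = begin
    evalL η (sh (a ∷ u) (b ∷ v)) ≈⟨ evalL-++₃ {η} (cons a (sh u (b ∷ v))) (cons b (sh (a ∷ u) v)) (cons (a ⊕ b) (sh u v)) ⟩
    _ ≈⟨ +-cong (evalL-η-cons a (sh u (b ∷ v))) (+-cong (evalL-η-cons b (sh (a ∷ u) v)) (evalL-η-cons (a ⊕ b) (sh u v))) ⟩
    _ ≈⟨ +-cong (ε-sh u (b ∷ v)) (+-cong (ε-sh (a ∷ u) v) (ε-sh u v)) ⟩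
    ε u * 0# + (0# * ε v + ε u * ε v) ≈⟨ +-cong (zeroʳ (ε u)) (+-cong (zeroˡ (ε v)) ≈-refl) ⟩
    0# + (0# + ε u * ε v) ≈⟨ ≈-trans (+-identityˡ _) (+-identityˡ _) ⟩
    ε u * ε v ≈⟨ ≈-sym (*-cong (≈-reflexive (η-cons a u)) (≈-reflexive (η-cons b v))) ⟩
    η (a ∷ u) * η (b ∷ v) ∎
    where open SR K-setoid

  η-⧢ : ∀ u v → evalL η (u ⧢ v) ≈ evalL η u * evalL η v
  η-⧢ u v = begin
    evalL η (ext₂ sh u v) ≈⟨ evalL-ext η _ u ⟩
    evalL (λ a → evalL η (ext (sh a) v)) u ≈⟨ evalL-pointwise u (λ a → ≈-trans (evalL-ext η (sh a) v) (evalL-pointwise v (λ b → η-sh a b))) ⟩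
    evalL (λ a → evalL (λ b → η a * η b) v) u ≈⟨ evalL-pointwise u (λ a → ≈-trans (evalL-pointwise v (λ b → *-comm (η a) (η b))) (evalL-*ʳ η (η a) v)) ⟩
    evalL (λ a → evalL η v * η a) u ≈⟨ evalL-pointwise u (λ a → *-comm _ (η a)) ⟩
    evalL (λ a → η a * evalL η v) u ≈⟨ evalL-*ʳ η (evalL η v) u ⟩
    evalL η u * evalL η v ∎
    where open SR K-setoid

  ext-addBlock : ∀ {b} {B : Set b} (F : Word × Word → Lin B) x p Y →
    ext F (addBlock x p Y) ∼ ext (λ y → ext (λ t → F (weight x p ∷ proj₁ y , t)) (sh (x ∷ p) (proj₂ y))) Y
  ext-addBlock F x p Y = ∼-trans (ext-ext F (addBlockᵇ x p) Y) (ext-pointwise Y (λ y → ext-basis-⊗ F (weight x p ∷ proj₁ y) (sh (x ∷ p) (proj₂ y))))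

  η⊗id-addBlock² : ∀ x p y p′ Z → ext (η ⊗Idₖ) (addBlock x p (addBlock y p′ Z)) ∼ []
  η⊗id-addBlock² x p y p′ Z = ∼-trans (ext-addBlock (η ⊗Idₖ) x p (addBlock y p′ Z))
    (∼-trans (ext-ext ηTerm (addBlockᵇ y p′) Z)
    (ext-zero Z (λ z → ∼-trans (ext-basis-⊗ ηTerm (weight y p′ ∷ proj₁ z) (sh (y ∷ p′) (proj₂ z)))
       (ext-zero (sh (y ∷ p′) (proj₂ z)) (λ w → ext-scale-zero (sh (x ∷ p) w) ⟦_⟧)))))
    where
    ηTerm : Word × Word → H
    ηTerm y′ = ext (λ t → (η ⊗Idₖ) (weight x p ∷ proj₁ y′ , t)) (sh (x ∷ p) (proj₂ y′))

  η⊗id-Γw : ∀ w → ext (η ⊗Idₖ) (Γw w) ∼ ⟦ w ⟧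
  η⊗id-Γw [] = ∼-trans (ext-basis (η ⊗Idₖ) ([] , [])) (scale-identityˡ ⟦ [] ⟧)
  η⊗id-Γw (x ∷ xs) = ∼-trans (ext-cong (η ⊗Idₖ) (Γw-∷ x xs))
    (∼-trans (ext-ext (η ⊗Idₖ) (addBlockΓ x) (Δw xs))
    (ext-Δw-last _ (λ p → ⟦ x ∷ p ⟧) xs h0 h1))
    where
    h0 : ∀ p → ext (η ⊗Idₖ) (addBlock x p (Γw [])) ∼ ⟦ x ∷ p ⟧
    h0 p = ∼-trans (ext-cong (η ⊗Idₖ) (ext-basis (addBlockᵇ x p) ([] , [])))
      (∼-trans (ext-cong (η ⊗Idₖ) (∼-trans (∼-reflexive (≡.cong (⟦ weight x p ∷ [] ⟧ ⊗_) (sh-identityʳ (x ∷ p)))) (⊗-basis (weight x p ∷ []) (x ∷ p))))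
      (∼-trans (ext-basis (η ⊗Idₖ) (weight x p ∷ [] , x ∷ p)) (scale-identityˡ ⟦ x ∷ p ⟧)))
    h1 : ∀ p y q → ext (η ⊗Idₖ) (addBlock x p (Γw (y ∷ q))) ∼ []
    h1 p y q = ∼-trans (ext-cong (η ⊗Idₖ) (addBlock-cong x p (Γw-∷ y q)))
      (∼-trans (ext-cong (η ⊗Idₖ) (ext-ext (addBlockᵇ x p) (addBlockΓ y) (Δw q)))
      (∼-trans (ext-ext (η ⊗Idₖ) _ (Δw q)) (ext-zero (Δw q) (λ s → η⊗id-addBlock² x p y (proj₁ s) (Γw (proj₂ s))))))

  id⊗η-addBlock-[] : ∀ x Y → ext (Idₖ⊗ η) (addBlock x [] Y) ∼ cons x (ext (Idₖ⊗ η) Y)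
  id⊗η-addBlock-[] x Y = ∼-trans (ext-addBlock (Idₖ⊗ η) x [] Y)
    (∼-trans (ext-pointwise Y (λ y → ∼-trans (ext-scale-evalL η ⟦ x ∷ proj₁ y ⟧ (sh (x ∷ []) (proj₂ y)))
        (scale-congˡ ⟦ x ∷ proj₁ y ⟧ (≈-trans (η-sh (x ∷ []) (proj₂ y)) (*-identityˡ _)))))
    (∼-reflexive (≡.sym (relabel-ext (x ∷_) (Idₖ⊗ η) Y))))

  id⊗η-addBlock-∷ : ∀ x y p Y → ext (Idₖ⊗ η) (addBlock x (y ∷ p) Y) ∼ []
  id⊗η-addBlock-∷ x y p Y = ∼-trans (ext-addBlock (Idₖ⊗ η) x (y ∷ p) Y)
    (ext-zero Y (λ z → ∼-trans (ext-scale-evalL η ⟦ weight x (y ∷ p) ∷ proj₁ z ⟧ (sh (x ∷ y ∷ p) (proj₂ z)))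
       (∼-trans (scale-congˡ ⟦ weight x (y ∷ p) ∷ proj₁ z ⟧ (≈-trans (η-sh (x ∷ y ∷ p) (proj₂ z)) (zeroˡ _))) (scale-zeroˡ _))))

  id⊗η-Γw : ∀ w → ext (Idₖ⊗ η) (Γw w) ∼ ⟦ w ⟧
  id⊗η-Γw [] = ∼-trans (ext-basis (Idₖ⊗ η) ([] , [])) (scale-identityˡ ⟦ [] ⟧)
  id⊗η-Γw (x ∷ xs) = ∼-trans (ext-cong (Idₖ⊗ η) (Γw-∷ x xs))
    (∼-trans (ext-ext (Idₖ⊗ η) (addBlockΓ x) (Δw xs))
    (ext-Δw-first _ xs (∼-trans (id⊗η-addBlock-[] x (Γw xs)) (cons-cong x (id⊗η-Γw xs)))
       (λ y p q → id⊗η-addBlock-∷ x y p (Γw q))))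

  ε⊗id-Γw : ∀ w → ext (ε ⊗Idₖ) (Γw w) ∼ scale (ε w) 𝟙
  ε⊗id-Γw [] = ext-basis (ε ⊗Idₖ) ([] , [])
  ε⊗id-Γw (x ∷ xs) = ∼-trans (ext-cong (ε ⊗Idₖ) (Γw-∷ x xs))
    (∼-trans (ext-ext (ε ⊗Idₖ) (addBlockΓ x) (Δw xs))
    (∼-trans (ext-zero (Δw xs) (λ s → ∼-trans (ext-addBlock (ε ⊗Idₖ) x (proj₁ s) (Γw (proj₂ s)))
        (ext-zero (Γw (proj₂ s)) (λ y → ext-scale-zero (sh (x ∷ proj₁ s) (proj₂ y)) ⟦_⟧))))
    (∼-sym (scale-zeroˡ 𝟙))))

  Γ-counitˡ : ∀ u → ext (η ⊗Idₖ) (Γ u) ∼ u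
  Γ-counitˡ u = ∼-trans (ext-ext (η ⊗Idₖ) Γw u) (∼-trans (ext-pointwise u η⊗id-Γw) (ext-⟦⟧ u))

  Γ-counitʳ : ∀ u → ext (Idₖ⊗ η) (Γ u) ∼ u
  Γ-counitʳ u = ∼-trans (ext-ext (Idₖ⊗ η) Γw u) (∼-trans (ext-pointwise u id⊗η-Γw) (ext-⟦⟧ u))

  Γ-ε : ∀ u → ext (ε ⊗Idₖ) (Γ u) ∼ uε u
  Γ-ε u = ∼-trans (ext-ext (ε ⊗Idₖ) Γw u) (ext-pointwise u ε⊗id-Γw)

  -- Coassociativity

  Word³ : Set o
  Word³ = Word × (Word × Word)

  assoc³ : (Word × Word) × Word → Word³
  assoc³ ((x , y) , z) = (x , (y , z))

  Γ⊗id : Word × Word → Lin ((Word × Word) × Word)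
  Γ⊗id = Γw ⊗ᶠ idᶠ

  id⊗Γ : Word × Word → Lin Word³
  id⊗Γ = idᶠ ⊗ᶠ Γw

  coassocˡ coassocʳ : Word → Lin Word³
  coassocˡ w = relabel assoc³ (ext Γ⊗id (Γw w))
  coassocʳ w = ext id⊗Γ (Γw w)

  addBlockᵀᵇ : Ω → Word → Word³ → Lin Word³
  addBlockᵀᵇ x p z = ⟦ weight x p ∷ proj₁ z ⟧ ⊗ (Γw (x ∷ p) ⧢₂ ⟦ proj₂ z ⟧)

  addBlockᵀ : Ω → Word → Lin Word³ → Lin Word³
  addBlockᵀ x p Z = ext (addBlockᵀᵇ x p) Z

  addBlockᵀ-cong : ∀ x p {Z Z′} → Z ∼ Z′ → addBlockᵀ x p Z ∼ addBlockᵀ x p Z′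
  addBlockᵀ-cong x p q = ext-cong (addBlockᵀᵇ x p) q

  id⊗Γ-addBlockᵇ : ∀ x p y → ext id⊗Γ (addBlockᵇ x p y) ∼ addBlockᵀ x p (id⊗Γ y)
  id⊗Γ-addBlockᵇ x p (W , P′) =
    ∼-trans (ext-basis-⊗ id⊗Γ cW S)
    (∼-trans (∼-sym (⊗-extʳ ⟦ cW ⟧ Γw S))
    (∼-trans (⊗-congʳ ⟦ cW ⟧ (Γw-sh (x ∷ p) P′))
    (∼-sym (∼-trans (ext-basis-⊗ (addBlockᵀᵇ x p) W (Γw P′))
      (∼-trans (∼-sym (⊗-extʳ ⟦ cW ⟧ (λ z → Γw (x ∷ p) ⧢₂ ⟦ z ⟧) (Γw P′)))
      (⊗-congʳ ⟦ cW ⟧ (∼-trans (∼-sym (ext₂-extʳ sh₂ ⟦_⟧ (Γw (x ∷ p)) (Γw P′))) (⧢₂-congʳ (Γw (x ∷ p)) (ext-⟦⟧ (Γw P′))))))))))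
    where
    cW : Word
    cW = weight x p ∷ W
    S : H
    S = sh (x ∷ p) P′

  id⊗Γ-addBlock : ∀ x p Y → ext id⊗Γ (addBlock x p Y) ∼ addBlockᵀ x p (ext id⊗Γ Y)
  id⊗Γ-addBlock x p Y = ∼-trans (ext-ext id⊗Γ (addBlockᵇ x p) Y) (∼-trans (ext-pointwise Y (id⊗Γ-addBlockᵇ x p)) (∼-sym (ext-ext (addBlockᵀᵇ x p) id⊗Γ Y)))

  coassocʳ-∷ : ∀ x xs → coassocʳ (x ∷ xs) ∼ ext (λ s → addBlockᵀ x (proj₁ s) (coassocʳ (proj₂ s))) (Δw xs)
  coassocʳ-∷ x xs = ∼-trans (ext-cong id⊗Γ (Γw-∷ x xs))
    (∼-trans (ext-ext id⊗Γ (addBlockΓ x) (Δw xs)) (ext-pointwise (Δw xs) (λ s → id⊗Γ-addBlock x (proj₁ s) (Γw (proj₂ s)))))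

  assoc³-⊗ : ∀ (w : Word) (X : H) (V : H) → relabel assoc³ ((⟦ w ⟧ ⊗ X) ⊗ V) ∼ ⟦ w ⟧ ⊗ (X ⊗ V)
  assoc³-⊗ w X V = ∼-trans (relabel-cong assoc³ (⊗-congˡ V (⊗-basisˡ w X)))
    (∼-trans (∼-reflexive (≡.trans (≡.cong (relabel assoc³) (≡.sym (relabel-⊗ˡ (w ,_) X V))) (relabel-relabel assoc³ _ (X ⊗ V))))
    (∼-sym (⊗-basisˡ w (X ⊗ V))))

  Coassoc : Word → Set _
  Coassoc w = coassocˡ w ∼ coassocʳ w

  -- Expanding Γ(x xs) by its recursion, both sides of Coassoc (x ∷ xs) become coassocTerms xs,
  -- a sum over the double deconcatenations xs = p r s; the left side gets there through the
  -- comodule identity, the right side by induction and coassociativity of Δ.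
  module _ (x : Ω) where

    tripleTerm : Word → Word × Word → Word × Word → Word × Word → Lin Word³
    tripleTerm p y z ab = ⟦ weight (weight x p) (proj₁ y) ∷ proj₁ ab ⟧ ⊗ (sh (weight x p ∷ proj₁ y) (proj₂ ab) ⊗ (⟦ x ∷ p ⟧ ⧢ sh (proj₂ y) (proj₂ z)))

    tripleTerms : Word → Word → Word → Lin Word³
    tripleTerms p r s = ext (λ y → ext (λ z → ext (λ ab → tripleTerm p y z ab) (Γw (proj₁ z))) (Γw s)) (Γw r)

    coassocTerms : Word → Lin Word³
    coassocTerms xs = ext (λ s → ext (λ t → tripleTerms (proj₁ s) (proj₁ t) (proj₂ t)) (Δw (proj₂ s))) (Δw xs)

    liftBlockᵇ : Word → (Word × Word) × Word → Lin ((Word × Word) × Word)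
    liftBlockᵇ p r = addBlock (weight x p) (proj₁ (proj₁ r)) (Γw (proj₂ (proj₁ r))) ⊗ sh (x ∷ p) (proj₂ r)

    liftBlock : Word → Lin ((Word × Word) × Word) → Lin ((Word × Word) × Word)
    liftBlock p Z = ext (liftBlockᵇ p) Z

    Γ⊗id-addBlockᵇ : ∀ p y → ext Γ⊗id (addBlockᵇ x p y) ∼ liftBlock p (Δ⊗id y)
    Γ⊗id-addBlockᵇ p (W , P′) =
      ∼-trans (ext-basis-⊗ Γ⊗id cW S)
      (∼-trans (∼-sym (⊗-extʳ (Γw cW) ⟦_⟧ S))
      (∼-trans (⊗-cong (Γw-∷ c′ W) (ext-⟦⟧ S))
      (∼-trans (⊗-extˡ (addBlockΓ c′) (Δw W) S)
      (∼-sym (∼-trans (ext-⊗ (liftBlockᵇ p) (Δw W) ⟦ P′ ⟧) (ext₂-basisʳ (λ w t → liftBlockᵇ p (w , t)) (Δw W) P′))))))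
      where
      c′ : Ω
      c′ = weight x p
      cW : Word
      cW = c′ ∷ W
      S : H
      S = sh (x ∷ p) P′

    Γ⊗id-addBlock : ∀ p Y → ext Γ⊗id (addBlock x p Y) ∼ liftBlock p (ext Δ⊗id Y)
    Γ⊗id-addBlock p Y = ∼-trans (ext-ext Γ⊗id (addBlockᵇ x p) Y) (∼-trans (ext-pointwise Y (Γ⊗id-addBlockᵇ p)) (∼-sym (ext-ext (liftBlockᵇ p) Δ⊗id Y)))

    liftedTerm : Word → Word × Word → Word × Word → Lin ((Word × Word) × Word)
    liftedTerm p y z = addBlock (weight x p) (proj₁ y) (Γw (proj₁ z)) ⊗ (⟦ x ∷ p ⟧ ⧢ sh (proj₂ y) (proj₂ z))

    liftBlockᵇ-m₂₄τ : ∀ p y z → liftBlock p (m₂₄τ (y , z)) ∼ liftedTerm p y z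
    liftBlockᵇ-m₂₄τ p y z = ∼-trans (∼-reflexive (ext-relabel (liftBlockᵇ p) _ (sh (proj₂ y) (proj₂ z))))
      (∼-trans (∼-sym (⊗-extʳ (addBlock (weight x p) (proj₁ y) (Γw (proj₁ z))) (sh (x ∷ p)) (sh (proj₂ y) (proj₂ z))))
      (⊗-congʳ (addBlock (weight x p) (proj₁ y) (Γw (proj₁ z))) (∼-sym (ext₂-basisˡ sh (x ∷ p) (sh (proj₂ y) (proj₂ z))))))

    liftBlock-m₂₄τ : ∀ p Y Z → liftBlock p (ext m₂₄τ (Y ⊗ Z)) ∼ ext₂ (liftedTerm p) Y Z
    liftBlock-m₂₄τ p Y Z = ∼-trans (ext-cong (liftBlockᵇ p) (ext-⊗ m₂₄τ Y Z))
      (∼-trans (ext-ext₂ (liftBlockᵇ p) (λ y z → m₂₄τ (y , z)) Y Z) (ext₂-pointwise Y Z (liftBlockᵇ-m₂₄τ p)))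

    assoc³-liftedTerm : ∀ p y z → relabel assoc³ (liftedTerm p y z) ∼ ext (λ ab → tripleTerm p y z ab) (Γw (proj₁ z))
    assoc³-liftedTerm p y z = ∼-trans (relabel-cong assoc³ (⊗-extˡ (addBlockᵇ (weight x p) (proj₁ y)) (Γw (proj₁ z)) V))
      (∼-trans (∼-reflexive (relabel-ext assoc³ _ (Γw (proj₁ z))))
      (ext-pointwise (Γw (proj₁ z)) (λ ab → assoc³-⊗ (weight (weight x p) (proj₁ y) ∷ proj₁ ab) (sh (weight x p ∷ proj₁ y) (proj₂ ab)) V)))
      where
      V : H
      V = ⟦ x ∷ p ⟧ ⧢ sh (proj₂ y) (proj₂ z)

    coassocˡ-∷ : ∀ xs (cm : AllSuffixes Comodule xs) → coassocˡ (x ∷ xs) ∼ coassocTerms xs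
    coassocˡ-∷ xs cm =
      ∼-trans (relabel-cong assoc³ (ext-cong Γ⊗id (Γw-∷ x xs)))
      (∼-trans (relabel-cong assoc³ (ext-ext Γ⊗id (addBlockΓ x) (Δw xs)))
      (∼-trans (relabel-cong assoc³ (ext-Δw-suffixwise xs (AllSuffixes-map (λ q h p →
          ∼-trans (Γ⊗id-addBlock p (Γw q)) (∼-trans (ext-cong (liftBlockᵇ p) h) (∼-trans (ext-cong (liftBlockᵇ p) (ext-ext m₂₄τ Γ⊗Γ (Δw q)))
          (∼-trans (ext-ext (liftBlockᵇ p) _ (Δw q)) (ext-pointwise (Δw q) (λ t → liftBlock-m₂₄τ p (Γw (proj₁ t)) (Γw (proj₂ t)))))))) xs cm)))
      (∼-trans (∼-reflexive (relabel-ext assoc³ _ (Δw xs)))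
      (ext-pointwise (Δw xs) (λ s → ∼-trans (∼-reflexive (relabel-ext assoc³ _ (Δw (proj₂ s))))
         (ext-pointwise (Δw (proj₂ s)) (λ t → ∼-trans (relabel-ext₂ assoc³ (liftedTerm (proj₁ s)) (Γw (proj₁ t)) (Γw (proj₂ t)))
            (ext₂-pointwise (Γw (proj₁ t)) (Γw (proj₂ t)) (assoc³-liftedTerm (proj₁ s))))))))))

    tripleTerm′ : Word → Word × Word → Word × Word → Word × Word → Word × Word → Lin Word³
    tripleTerm′ p′ t y z ab = ⟦ weight x p′ ∷ proj₁ ab ⟧ ⊗ (sh (weight x (proj₁ t) ∷ proj₁ y) (proj₂ ab) ⊗ (⟦ x ∷ proj₁ t ⟧ ⧢ sh (proj₂ y) (proj₂ z)))

    addBlockᵀᵇ-expand : ∀ p′ z ab → addBlockᵀᵇ x p′ (proj₁ ab , (proj₂ ab , proj₂ z)) ∼ ext (λ t → ext (λ y → tripleTerm′ p′ t y z ab) (Γw (proj₂ t))) (Δw p′)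
    addBlockᵀᵇ-expand p′ z ab =
      ∼-trans (⊗-congʳ ⟦ c′A ⟧ (⧢₂-congˡ V0 (Γw-∷ x p′)))
      (∼-trans (⊗-congʳ ⟦ c′A ⟧ (ext₂-extˡ sh₂ (addBlockΓ x) (Δw p′) V0))
      (∼-trans (⊗-extʳ ⟦ c′A ⟧ (λ t → addBlockΓ x t ⧢₂ V0) (Δw p′))
      (ext-pointwise (Δw p′) (λ t →
        ∼-trans (⊗-congʳ ⟦ c′A ⟧ (ext₂-extˡ sh₂ (addBlockᵇ x (proj₁ t)) (Γw (proj₂ t)) V0))
        (∼-trans (⊗-extʳ ⟦ c′A ⟧ (λ y → addBlockᵇ x (proj₁ t) y ⧢₂ V0) (Γw (proj₂ t)))
        (ext-pointwise (Γw (proj₂ t)) (λ y → ⊗-congʳ ⟦ c′A ⟧ (∼-trans (⊗-⧢₂-basis (weight x (proj₁ t)) (proj₁ y) (sh (x ∷ proj₁ t) (proj₂ y)) (proj₂ ab) (proj₂ z))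
            (⊗-congʳ (sh (weight x (proj₁ t) ∷ proj₁ y) (proj₂ ab)) (∼-trans (⧢-congˡ ⟦ proj₂ z ⟧ (∼-sym (⧢-basis (x ∷ proj₁ t) (proj₂ y))))
              (∼-trans (⧢-assoc ⟦ x ∷ proj₁ t ⟧ ⟦ proj₂ y ⟧ ⟦ proj₂ z ⟧)
                (⧢-congʳ ⟦ x ∷ proj₁ t ⟧ (⧢-basis (proj₂ y) (proj₂ z))))))))))))))
      where
      c′A : Word
      c′A = weight x p′ ∷ proj₁ ab
      V0 : H₂
      V0 = ⟦ (proj₂ ab , proj₂ z) ⟧

    tripleTerm′≈tripleTerm : ∀ p′ z ab → ext (λ t → ext (λ y → tripleTerm′ p′ t y z ab) (Γw (proj₂ t))) (Δw p′)
                                        ∼ ext (λ t → ext (λ y → tripleTerm (proj₁ t) y z ab) (Γw (proj₂ t))) (Δw p′)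
    tripleTerm′≈tripleTerm p′ z ab = ext-pointwise-on (Δw-splits p′) (λ t e1 → ext-pointwise-on (Γw-weight (proj₂ t)) (λ y e2 →
      ∼-reflexive (≡.cong (λ k → ⟦ k ∷ proj₁ ab ⟧ ⊗ (sh (weight x (proj₁ t) ∷ proj₁ y) (proj₂ ab) ⊗ (⟦ x ∷ proj₁ t ⟧ ⧢ sh (proj₂ y) (proj₂ z))))
        (≡.trans (≡.cong (weight x) (≡.sym e1)) (weight-++ x (proj₁ t) (proj₂ t) (proj₁ y) e2)))))

    addBlockᵀ-coassocˡ : ∀ p′ q′ → addBlockᵀ x p′ (coassocˡ q′) ∼ ext (λ t → tripleTerms (proj₁ t) (proj₂ t) q′) (Δw p′)
    addBlockᵀ-coassocˡ p′ q′ =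
      ∼-trans (addBlockᵀ-cong x p′ (∼-reflexive (relabel-ext assoc³ Γ⊗id (Γw q′))))
      (∼-trans (ext-ext (addBlockᵀᵇ x p′) (λ z → relabel assoc³ (Γ⊗id z)) (Γw q′))
      (∼-trans (ext-pointwise (Γw q′) (λ z → ∼-trans (addBlockᵀ-cong x p′ (∼-trans (relabel-cong assoc³ (⊗-basisʳ (Γw (proj₁ z)) (proj₂ z)))
                   (∼-trans (∼-reflexive (relabel-relabel assoc³ (_, proj₂ z) (Γw (proj₁ z)))) (relabel-as-ext (λ ab → (proj₁ ab , (proj₂ ab , proj₂ z))) (Γw (proj₁ z))))))
                (∼-trans (ext-ext (addBlockᵀᵇ x p′) (λ ab → ⟦ (proj₁ ab , (proj₂ ab , proj₂ z)) ⟧) (Γw (proj₁ z)))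
                (ext-pointwise (Γw (proj₁ z)) (λ ab → ∼-trans (ext-basis (addBlockᵀᵇ x p′) (proj₁ ab , (proj₂ ab , proj₂ z)))
                  (∼-trans (addBlockᵀᵇ-expand p′ z ab) (tripleTerm′≈tripleTerm p′ z ab)))))))
      (∼-trans (ext-pointwise (Γw q′) (λ z → ext-comm (λ ab t → ext (λ y → tripleTerm (proj₁ t) y z ab) (Γw (proj₂ t))) (Γw (proj₁ z)) (Δw p′)))
      (∼-trans (ext-comm (λ z t → ext (λ ab → ext (λ y → tripleTerm (proj₁ t) y z ab) (Γw (proj₂ t))) (Γw (proj₁ z))) (Γw q′) (Δw p′))
      (ext-pointwise (Δw p′) (λ t → ∼-trans (ext-pointwise (Γw q′) (λ z → ext-comm (λ ab y → tripleTerm (proj₁ t) y z ab) (Γw (proj₁ z)) (Γw (proj₂ t))))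
         (ext-comm (λ z y → ext (λ ab → tripleTerm (proj₁ t) y z ab) (Γw (proj₁ z))) (Γw q′) (Γw (proj₂ t)))))))))

    addBlockᵀ-coassocˡ-Δw : ∀ xs → ext (λ s → addBlockᵀ x (proj₁ s) (coassocˡ (proj₂ s))) (Δw xs) ∼ coassocTerms xs
    addBlockᵀ-coassocˡ-Δw xs = ∼-trans (ext-pointwise (Δw xs) (λ s → addBlockᵀ-coassocˡ (proj₁ s) (proj₂ s))) (Δw-coassoc tripleTerms xs)

  coassoc-step : ∀ x xs → AllSuffixes Coassoc xs → Coassoc (x ∷ xs)
  coassoc-step x xs ih = ∼-trans (coassocˡ-∷ x xs (AllSuffixes-map (λ w _ → Γw-comodule w) xs ih))
    (∼-trans (∼-sym (addBlockᵀ-coassocˡ-Δw x xs))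
    (∼-trans (ext-Δw-suffixwise xs (AllSuffixes-map (λ q h p → addBlockᵀ-cong x p h) xs ih)) (∼-sym (coassocʳ-∷ x xs))))

  coassoc-[] : Coassoc []
  coassoc-[] = ∼-trans (relabel-cong assoc³ (ext-basis Γ⊗id ([] , [])))
    (∼-trans (relabel-cong assoc³ (⊗-basis ([] , []) []))
    (∼-sym (∼-trans (ext-basis id⊗Γ ([] , [])) (⊗-basis [] ([] , [])))))

  coassoc-suffixes : ∀ w → AllSuffixes Coassoc w
  coassoc-suffixes [] = coassoc-[]
  coassoc-suffixes (x ∷ xs) = coassoc-step x xs (coassoc-suffixes xs) , coassoc-suffixes xs

  Γ-coassoc : ∀ u → assocʳ (ext (Γw ⊗ᶠ idᶠ) (Γ u)) ∼ ext (idᶠ ⊗ᶠ Γw) (Γ u)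
  Γ-coassoc u = ∼-trans (relabel-cong assoc³ (ext-ext Γ⊗id Γw u))
    (∼-trans (∼-reflexive (relabel-ext assoc³ _ u))
    (∼-trans (ext-pointwise u (λ w → AllSuffixes-head w (coassoc-suffixes w)))
    (∼-sym (ext-ext id⊗Γ Γw u))))

  -- The antipode

  infixl 7 _⋆_
  _⋆_ : (Word → H₂) → (Word → H₂) → Word → H₂
  (f ⋆ g) w = ext (λ s → f (proj₁ s) ⧢₂ g (proj₂ s)) (Δw w)

  ε₂ : Word → H₂
  ε₂ w = scale (ε w) 𝟙₂

  ⋆-congˡ : ∀ {f f′} g → (∀ w → f w ∼ f′ w) → ∀ w → (f ⋆ g) w ∼ (f′ ⋆ g) w
  ⋆-congˡ g hf w = ext-pointwise (Δw w) (λ s → ⧢₂-congˡ (g (proj₂ s)) (hf (proj₁ s)))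

  ⋆-congʳ : ∀ f {g g′} → (∀ w → g w ∼ g′ w) → ∀ w → (f ⋆ g) w ∼ (f ⋆ g′) w
  ⋆-congʳ f hg w = ext-pointwise (Δw w) (λ s → ⧢₂-congʳ (f (proj₁ s)) (hg (proj₂ s)))

  ⋆-identityˡ : ∀ f w → (ε₂ ⋆ f) w ∼ f w
  ⋆-identityˡ f w = ext-Δw-first (λ s → ε₂ (proj₁ s) ⧢₂ f (proj₂ s)) w
    (∼-trans (⧢₂-congˡ (f w) (scale-identityˡ 𝟙₂)) (⧢₂-identityˡ (f w)))
    (λ y p q → ⧢₂-congˡ (f q) (scale-zeroˡ 𝟙₂))

  ⋆-identityʳ : ∀ f w → (f ⋆ ε₂) w ∼ f w
  ⋆-identityʳ f w = ext-Δw-last (λ s → f (proj₁ s) ⧢₂ ε₂ (proj₂ s)) f w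
    (λ p → ∼-trans (⧢₂-congʳ (f p) (scale-identityˡ 𝟙₂)) (⧢₂-identityʳ (f p)))
    (λ p y q → ∼-trans (⧢₂-congʳ (f p) (scale-zeroˡ 𝟙₂)) (ext-empty (f p)))

  ⋆-assoc : ∀ f g h w → ((f ⋆ g) ⋆ h) w ∼ (f ⋆ (g ⋆ h)) w
  ⋆-assoc f g h w =
    ∼-trans (ext-pointwise (Δw w) (λ s → ext₂-extˡ sh₂ (λ t → f (proj₁ t) ⧢₂ g (proj₂ t)) (Δw (proj₁ s)) (h (proj₂ s))))
    (∼-trans (Δw-coassoc (λ p r q → (f p ⧢₂ g r) ⧢₂ h q) w)
    (ext-pointwise (Δw w) (λ s → ∼-trans (ext-pointwise (Δw (proj₂ s)) (λ t → ⧢₂-assoc (f (proj₁ s)) (g (proj₁ t)) (h (proj₂ t))))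
       (∼-sym (ext₂-extʳ sh₂ (λ t → g (proj₁ t) ⧢₂ h (proj₂ t)) (f (proj₁ s)) (Δw (proj₂ s)))))))

  Γ-scale-𝟙 : ∀ k → Γ (scale k 𝟙) ∼ scale k 𝟙₂
  Γ-scale-𝟙 k = ∼-trans (ext-scale Γw k 𝟙) (scale-congʳ k Γ-𝟙)

  module Antipode (S : Word → H) (isAntipode : IsAntipode S) where

    ΓS S⊗idΓ : Word → H₂
    ΓS w = Γ (S w)
    S⊗idΓ w = ext (S ⊗ᶠ idᶠ) (Γw w)

    private
      antipodeˡ : ∀ w → ext m[ S ⊗Id] (Δw w) ∼ scale (ε w) 𝟙
      antipodeˡ w = ∼-trans (ext-cong m[ S ⊗Id] (∼-sym (ext-basis Δw w)))
        (∼-trans (proj₁ isAntipode ⟦ w ⟧) (ext-basis (λ w → scale (ε w) 𝟙) w))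

      antipodeʳ : ∀ w → ext m[Id⊗ S ] (Δw w) ∼ scale (ε w) 𝟙
      antipodeʳ w = ∼-trans (ext-cong m[Id⊗ S ] (∼-sym (ext-basis Δw w)))
        (∼-trans (proj₂ isAntipode ⟦ w ⟧) (ext-basis (λ w → scale (ε w) 𝟙) w))

    Γw⋆ΓS : ∀ w → (Γw ⋆ ΓS) w ∼ ε₂ w
    Γw⋆ΓS w = ∼-trans (ext-pointwise (Δw w) (λ s → ∼-trans (⧢₂-congˡ (ΓS (proj₂ s)) (∼-sym (ext-basis Γw (proj₁ s))))
                                              (∼-sym (Γ-⧢ ⟦ proj₁ s ⟧ (S (proj₂ s))))))
      (∼-trans (∼-sym (ext-ext Γw m[Id⊗ S ] (Δw w)))
      (∼-trans (ext-cong Γw (antipodeʳ w)) (Γ-scale-𝟙 (ε w))))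

    mS : (Word × Word) × Word → H₂
    mS ((x , y) , z) = (S x ⧢ ⟦ y ⟧) ⊗ ⟦ z ⟧

    mS-Δ⊗id-Γw : ∀ w → ext mS (ext Δ⊗id (Γw w)) ∼ ε₂ w
    mS-Δ⊗id-Γw w = ∼-trans (ext-ext mS Δ⊗id (Γw w))
      (∼-trans (ext-pointwise (Γw w) (λ y → ∼-trans (ext-⊗ mS (Δw (proj₁ y)) ⟦ proj₂ y ⟧)
          (∼-trans (ext₂-basisʳ (λ a b → mS (a , b)) (Δw (proj₁ y)) (proj₂ y))
          (∼-trans (∼-sym (⊗-extˡ m[ S ⊗Id] (Δw (proj₁ y)) ⟦ proj₂ y ⟧))
          (∼-trans (⊗-congˡ ⟦ proj₂ y ⟧ (antipodeˡ (proj₁ y)))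
          (⊗-basisʳ (scale (ε (proj₁ y)) 𝟙) (proj₂ y)))))))
      (∼-trans (∼-reflexive (≡.sym (relabel-ext (λ t → ([] , t)) (ε ⊗Idₖ) (Γw w))))
      (relabel-cong (λ t → ([] , t)) (ε⊗id-Γw w))))

    mS-m₂₄τ : ∀ y z → ext mS (m₂₄τ (y , z)) ∼ ext (λ v → sh₂ v z) ((S ⊗ᶠ idᶠ) y)
    mS-m₂₄τ (W₁ , P₁) (W₂ , P₂) =
      ∼-trans (∼-reflexive (ext-relabel mS _ (sh P₁ P₂)))
      (∼-trans (∼-sym (⊗-extʳ (S W₁ ⧢ ⟦ W₂ ⟧) ⟦_⟧ (sh P₁ P₂)))
      (∼-trans (⊗-congʳ (S W₁ ⧢ ⟦ W₂ ⟧) (∼-trans (ext-⟦⟧ (sh P₁ P₂)) (∼-sym (⧢-basis P₁ P₂))))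
      (∼-sym (∼-trans (∼-sym (ext₂-basisʳ sh₂ (S W₁ ⊗ ⟦ P₁ ⟧) (W₂ , P₂)))
        (∼-trans (⧢₂-congʳ (S W₁ ⊗ ⟦ P₁ ⟧) (⟦⟧-⊗ (W₂ , P₂)))
        (⧢₂-⊗ (S W₁) ⟦ P₁ ⟧ ⟦ W₂ ⟧ ⟦ P₂ ⟧))))))

    mS-m₂₄τ-Γ⊗Γ-Δw : ∀ w → ext mS (ext m₂₄τ (ext Γ⊗Γ (Δw w))) ∼ (S⊗idΓ ⋆ Γw) w
    mS-m₂₄τ-Γ⊗Γ-Δw w = ∼-trans (ext-cong mS (ext-ext m₂₄τ Γ⊗Γ (Δw w)))
      (∼-trans (ext-ext mS _ (Δw w))
      (ext-pointwise (Δw w) (λ s → ∼-trans (ext-cong mS (ext-⊗ m₂₄τ (Γw (proj₁ s)) (Γw (proj₂ s))))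
         (∼-trans (ext-ext₂ mS (λ y z → m₂₄τ (y , z)) (Γw (proj₁ s)) (Γw (proj₂ s)))
         (∼-trans (ext₂-pointwise (Γw (proj₁ s)) (Γw (proj₂ s)) mS-m₂₄τ)
         (∼-sym (ext₂-extˡ′ sh₂ (S ⊗ᶠ idᶠ) (Γw (proj₁ s)) (Γw (proj₂ s)))))))))

    S⊗idΓ⋆Γw : ∀ w → (S⊗idΓ ⋆ Γw) w ∼ ε₂ w
    S⊗idΓ⋆Γw w = ∼-trans (∼-sym (mS-m₂₄τ-Γ⊗Γ-Δw w)) (∼-trans (ext-cong mS (∼-sym (Γw-comodule w))) (mS-Δ⊗id-Γw w))

    S⊗idΓ≈ΓS : ∀ w → S⊗idΓ w ∼ ΓS w
    S⊗idΓ≈ΓS w = begin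
      S⊗idΓ w                ≈⟨ ⋆-identityʳ S⊗idΓ w ⟨
      (S⊗idΓ ⋆ ε₂) w         ≈⟨ ⋆-congʳ S⊗idΓ Γw⋆ΓS w ⟨
      (S⊗idΓ ⋆ (Γw ⋆ ΓS)) w  ≈⟨ ⋆-assoc S⊗idΓ Γw ΓS w ⟨
      ((S⊗idΓ ⋆ Γw) ⋆ ΓS) w  ≈⟨ ⋆-congˡ ΓS S⊗idΓ⋆Γw w ⟩
      (ε₂ ⋆ ΓS) w            ≈⟨ ⋆-identityˡ ΓS w ⟩
      ΓS w                   ∎
      where open SR (∼-setoid (Word × Word))

    Γ-antipode : ∀ u → ext (S ⊗ᶠ idᶠ) (Γ u) ∼ Γ (ext S u)
    Γ-antipode u = ∼-trans (ext-ext (S ⊗ᶠ idᶠ) Γw u) (∼-trans (ext-pointwise u S⊗idΓ≈ΓS) (∼-sym (ext-ext Γw S u)))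

module NonCocommutativity {c ℓ o} (K : Field c ℓ) (Ω : Set o) (_⊕_ : Ω → Ω → Ω) where

  open Field K renaming (refl to ≈-refl; sym to ≈-sym; trans to ≈-trans)
  open QuasiShuffle K Ω _⊕_

  -- Γ(ab) = ab ⊗ ab + ab ⊗ ba + ab ⊗ [a+b] + [a+b] ⊗ ab, so the basis element ab ⊗ ba
  -- has coefficient 1 in Γ(ab) and coefficient 0 in its flip.
  module _ {a b : Ω} (a≢b : ¬ (a ≡ b)) where

    private
      ab ba : Word
      ab = a ∷ b ∷ []
      ba = b ∷ a ∷ []

    private
      ab⊗ba : Word × Word
      ab⊗ba = (ab , ba)

      ab⊗ab≢ab⊗ba : ¬ ((ab , ab) ≡ ab⊗ba)
      ab⊗ab≢ab⊗ba eq = a≢b (∷-injectiveˡ (,-injectiveʳ eq))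

      ba⊗ab≢ab⊗ba : ¬ ((ba , ab) ≡ ab⊗ba)
      ba⊗ab≢ab⊗ba eq = a≢b (≡.sym (∷-injectiveˡ (,-injectiveˡ eq)))

      ab⊗a+b≢ab⊗ba : ¬ ((ab , (a ⊕ b) ∷ []) ≡ ab⊗ba)
      ab⊗a+b≢ab⊗ba ()

      a+b⊗ab≢ab⊗ba : ¬ (((a ⊕ b) ∷ [] , ab) ≡ ab⊗ba)
      a+b⊗ab≢ab⊗ba ()

    open LinearAlgebra.Coefficient K ab⊗ba

    coefficient-Γ : ∃ λ k → CoefficientIs (Γ ⟦ ab ⟧) k × k ≈ 1#
    coefficient-Γ = _ , miss ab⊗ab≢ab⊗ba (hit (miss ab⊗a+b≢ab⊗ba (miss a+b⊗ab≢ab⊗ba nil))) ,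
      ≈-trans (+-identityʳ _) (≈-trans (*-identityˡ _) (≈-trans (*-identityˡ _) (≈-trans (*-identityˡ _)
        (≈-trans (*-identityʳ _) (≈-trans (*-identityˡ _) (*-identityˡ _))))))

    coefficient-flipΓ : CoefficientIs (flipT (Γ ⟦ ab ⟧)) 0#
    coefficient-flipΓ = miss ab⊗ab≢ab⊗ba (miss ba⊗ab≢ab⊗ba (miss a+b⊗ab≢ab⊗ba (miss ab⊗a+b≢ab⊗ba nil)))

    ¬cocommutative : ¬ Cocommutative
    ¬cocommutative cocomm with coefficient-Γ
    ... | _ , coeff , k≈1 = coefficient-resp-∼ (cocomm ⟦ ab ⟧) coeff coefficient-flipΓ (λ k≈0 → 1≉0 (≈-trans (≈-sym k≈1) k≈0))

  Γ-noncocommutative : (∃₂ λ (a b : Ω) → ¬ (a ≡ b)) → ¬ Cocommutative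
  Γ-noncocommutative (_ , _ , a≢b) = ¬cocommutative a≢b

theorem3p1 : ∀ {c ℓ o} (K : Field c ℓ) (Ω : Set o) (_⊕_ : Ω → Ω → Ω) →
    IsCommutativeSemigroup _≡_ _⊕_ →
    let open Field K
        open QuasiShuffle K Ω _⊕_
    in
    -- (i) (H, ⧢, Γ) is a bialgebra, Γ noncocommutative
    ( (∀ u → assocʳ (ext (Γw ⊗ᶠ idᶠ) (Γ u)) ∼ ext (idᶠ ⊗ᶠ Γw) (Γ u))
    × ((∃₂ λ (a b : Ω) → ¬ (a ≡ b)) → ¬ Cocommutative)
    × (∀ u v → Γ (u ⧢ v) ∼ Γ u ⧢₂ Γ v)
    × (Γ 𝟙 ∼ ⟦ ([] , []) ⟧)
    × (∃ λ (η : Word → Carrier) →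
         (∀ u → ext (η ⊗Idₖ) (Γ u) ∼ u)
       × (∀ u → ext (Idₖ⊗ η) (Γ u) ∼ u)
       × (η [] ≈ 1#)
       × (∀ u v → evalL η (u ⧢ v) ≈ evalL η u * evalL η v)) )
    -- (ii) (H, ⧢, Δ) is a right comodule-Hopf algebra over (H, ⧢, Γ)
    × ( (∀ u → ext (Δw ⊗ᶠ idᶠ) (Γ u) ∼ ext m₂₄τ (ext (Γw ⊗ᶠ Γw) (Δ u)))
      × (∀ u → ext (ε ⊗Idₖ) (Γ u) ∼ uε u)
      × (∀ (S : Word → H) → IsAntipode S → ∀ u → ext (S ⊗ᶠ idᶠ) (Γ u) ∼ Γ (ext S u)) )
theorem3p1 K Ω _⊕_ isCS =
  ( Γ-coassoc , Γ-noncocommutative , Γ-⧢ , Γ-𝟙 , (η , Γ-counitˡ , Γ-counitʳ , Field.refl K , η-⧢) )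
  , ( Γ-comodule , Γ-ε , Antipode.Γ-antipode )
  where
  open QuasiShuffleBialgebra K Ω _⊕_ isCS
  open NonCocommutativity K Ω _⊕_
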